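{- Let $G=(V,E)$ be a finite, connected, undirected multigraph (multiple edges allowed, no self-loops). Let $\Gamma$ be the family of spanning trees of $G$, each identified with its indicator vector $\mathbb{1}_\gamma\in\mathbb{R}^E$. Then the Fulkerson blocker family $\widehat{\Gamma}$ of $\Gamma$ is exactly the set of vectors $$\frac{1}{k_P-1}\mathbb{1}_{E_P}\in\mathbb{R}^E,$$ where $P$ ranges over all feasible partitions of $V$ whose shrunk graph $G_P$ is vertex-biconnected.
   Context: For a finite set $\Gamma\subset\mathbb{R}^E_{\ge0}$ of usage vectors, the admissible set is $\mathrm{Adm}(\Gamma)=\{\rho\in\mathbb{R}^E_{\ge 0}: \sum_{e\in E}\gamma(e)\rho(e)\ge 1\ \forall \gamma\in\Gamma\}$, and the Fulkerson blocker family $\widehat{\Gamma}$ is the set of extreme points of $\mathrm{Adm}(\Gamma)$. A feasible partition of $V$ is a partition $P=\{V_1,\dots,V_{k_P}\}$ with $k_P\ge 2$ such that each induced subgraph $G(V_i)$ is connected; its cut set $E_P$ is the set of edges of $G$ joining vertices in different parts. The shrunk graph $G_P$ is obtained by identifying all vertices of each $V_i$ to a single vertex and deleting resulting self-loops; it has $k_P$ vertices and edge set $E_P$. A graph is vertex-biconnected if it has at least two vertices, is connected, and removing any single vertex together with its incident edges does not disconnect it.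
   Formalization: The vectors ρ and the points of $\mathrm{Adm}(\Gamma)$ lie in ℚ^E instead of ℝ^E, and the weights of the convex combinations that test extremeness are rational. -}

module Defs where

open import Data.Nat using (ℕ; zero; suc)
open import Data.Fin using (Fin; zero; suc; _≟_)
open import Data.Bool using (Bool; true; false; if_then_else_)
open import Data.Product using (_×_; _,_; proj₁; proj₂; Σ; ∃)
open import Data.Unit using (⊤)
open import Data.Integer using (+_)
open import Data.Rational using (ℚ; 0ℚ; 1ℚ; _+_; _*_; _-_; _≤_; _<_; _/_)
open import Relation.Nullary using (¬_; does)
open import Relation.Binary.PropositionalEquality using (_≡_; _≢_)
open import Function using (Surjective)
open import Relation.Binary.PropositionalEquality using (_≡_)

-- A finite multigraph on vertex set Fin n with edge set Fin m;
-- edge e has endpoints  ends e = (s, t).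

Σℚ : ∀ {m} → (Fin m → ℚ) → ℚ
Σℚ {zero}  f = 0ℚ
Σℚ {suc m} f = f zero + Σℚ (λ i → f (suc i))

data Reach {n m : ℕ} (ends : Fin m → Fin n × Fin n)
           (W : Fin n → Set) (S : Fin m → Set) : Fin n → Fin n → Set where
  here  : ∀ {u} → Reach ends W S u u
  stepˡ : ∀ {v} (e : Fin m) → S e → W (proj₁ (ends e)) → W (proj₂ (ends e)) →
          Reach ends W S (proj₂ (ends e)) v → Reach ends W S (proj₁ (ends e)) v
  stepʳ : ∀ {v} (e : Fin m) → S e → W (proj₁ (ends e)) → W (proj₂ (ends e)) →
          Reach ends W S (proj₁ (ends e)) v → Reach ends W S (proj₂ (ends e)) v

Connected : ∀ {n m} → (Fin m → Fin n × Fin n) → Set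
Connected {n} ends = (u v : Fin n) → Reach ends (λ _ → ⊤) (λ _ → ⊤) u v

Loopless : ∀ {n m} → (Fin m → Fin n × Fin n) → Set
Loopless {m = m} ends = (e : Fin m) → proj₁ (ends e) ≢ proj₂ (ends e)

-- Spanning tree (edge subset T): the spanning subgraph (V,T) is connected
-- and acyclic, acyclicity meaning no edge of T lies on a cycle of T, i.e.
-- removing any edge e of T leaves its endpoints disconnected in T.
IsSpanningTree : ∀ {n m} → (Fin m → Fin n × Fin n) → (Fin m → Bool) → Set
IsSpanningTree {n} {m} ends T =
  ((u v : Fin n) → Reach ends (λ _ → ⊤) (λ f → T f ≡ true) u v) ×
  ((e : Fin m) → T e ≡ true →
     ¬ Reach ends (λ _ → ⊤) (λ f → (T f ≡ true) × (f ≢ e))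
             (proj₁ (ends e)) (proj₂ (ends e)))

𝟙 : ∀ {m} → (Fin m → Bool) → Fin m → ℚ
𝟙 T e = if T e then 1ℚ else 0ℚ

Adm : ∀ {n m} → (Fin m → Fin n × Fin n) → (Fin m → ℚ) → Set
Adm {n} {m} ends ρ =
  ((e : Fin m) → 0ℚ ≤ ρ e) ×
  ((T : Fin m → Bool) → IsSpanningTree ends T →
     1ℚ ≤ Σℚ (λ e → 𝟙 T e * ρ e))

-- Extreme points of Adm(Γ): the Fulkerson blocker family.
IsBlocker : ∀ {n m} → (Fin m → Fin n × Fin n) → (Fin m → ℚ) → Set
IsBlocker {n} {m} ends ρ =
  Adm ends ρ ×
  ((a b : Fin m → ℚ) (t : ℚ) → Adm ends a → Adm ends b →
     0ℚ < t → t < 1ℚ →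
     ((e : Fin m) → ρ e ≡ t * a e + (1ℚ - t) * b e) →
     ((e : Fin m) → a e ≡ ρ e) × ((e : Fin m) → b e ≡ ρ e))

-- A partition of V into k parts, given by a surjective labelling
-- p : Fin n → Fin k (part i = p⁻¹(i)); feasible if every induced
-- subgraph G(V_i) is connected.
FeasiblePartition : ∀ {n m k} → (Fin m → Fin n × Fin n) → (Fin n → Fin k) → Set
FeasiblePartition {n} {m} {k} ends p =
  Surjective _≡_ _≡_ p ×
  ((i : Fin k) (u v : Fin n) → p u ≡ i → p v ≡ i →
     Reach ends (λ w → p w ≡ i) (λ _ → ⊤) u v)

IsCut : ∀ {n m k} → (Fin m → Fin n × Fin n) → (Fin n → Fin k) → Fin m → Set
IsCut ends p e = p (proj₁ (ends e)) ≢ p (proj₂ (ends e))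

-- Shrunk graph G_P: vertices Fin k, edges E_P, endpoints mapped by p.
shrunkEnds : ∀ {n m k} → (Fin m → Fin n × Fin n) → (Fin n → Fin k) → Fin m → Fin k × Fin k
shrunkEnds ends p e = p (proj₁ (ends e)) , p (proj₂ (ends e))

-- Vertex-biconnectivity of G_P (k ≥ 2 is imposed by the caller):
-- connected, and connected after deleting any single vertex x.
ShrunkBiconnected : ∀ {n m k} → (Fin m → Fin n × Fin n) → (Fin n → Fin k) → Set
ShrunkBiconnected {n} {m} {k} ends p =
  ((a b : Fin k) → Reach (shrunkEnds ends p) (λ _ → ⊤) (IsCut ends p) a b) ×
  ((x a b : Fin k) → a ≢ x → b ≢ x →
     Reach (shrunkEnds ends p) (λ w → w ≢ x) (IsCut ends p) a b)

-- The vector (1/(k_P - 1)) 𝟙_{E_P}, with k_P = 2 + j.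
cutVector : ∀ {n m} (j : ℕ) → (Fin m → Fin n × Fin n) → (Fin n → Fin (suc (suc j))) → Fin m → ℚ
cutVector j ends p e =
  if does (p (proj₁ (ends e)) ≟ p (proj₂ (ends e))) then 0ℚ else (+ 1 / suc j)

module Submission where

-- Every spanning tree meets at least k_P - 1 edges of the cut E_P
-- of a partition P, with equality for the "tight" trees that restrict to
-- spanning trees of the parts; so 𝟙_{E_P}/(k_P - 1) is admissible.  If P is
-- feasible with G_P biconnected and this cut vector is a proper convex
-- combination of admissible a and b, then a vanishes on internal edges and has
-- weight 1 on tight trees.  Exchanging, inside a tight tree, a cut edge for
-- another cut edge leaving the same part (a path around that part exists by
-- biconnectivity) shows that a is constant on E_P, and one tight tree fixes the
-- constant.  Conversely, for an extreme ρ let P be the components of the edges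
-- where ρ vanishes, and μ > 0 the least value of ρ on E_P.  Either the cut vector
-- lies below ρ, or ρ is a proper convex combination of the cut vector and an
-- admissible vector; both force ρ to be the cut vector.  Finally, if a vertex x
-- separated G_P, splitting P into the two sides of x (each together with x)
-- would exhibit the cut vector as a proper convex combination of the two
-- smaller cut vectors.

open import Data.Bool using (Bool; true; false; if_then_else_; _∧_; _∨_; not)
open import Data.Bool.Properties using (∧-identityʳ) renaming (_≟_ to _≟ᵇ_)
open import Data.Empty using (⊥; ⊥-elim)
open import Data.Fin using (Fin; zero; suc; punchOut; _≟_)
open import Data.Fin.Properties using (any?; all?; ¬∀⟶∃¬; punchOut-injective; punchOut-cong; suc-injective; ¬Fin0)
import Data.Integer as ℤ
import Data.Integer.Properties as ℤ
open import Data.List using (List; []; _∷_; allFin; tabulate)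
open import Data.List.Membership.Propositional using (_∈_)
open import Data.List.Membership.Propositional.Properties using (∈-allFin)
open import Data.List.Relation.Unary.All using (All; lookup)
open import Data.List.Relation.Unary.AllPairs using (_∷_)
open import Data.List.Relation.Unary.Any using (here; there)
open import Data.List.Relation.Unary.Unique.Propositional using (Unique)
open import Data.List.Relation.Unary.Unique.Propositional.Properties using (allFin⁺)
open import Data.Nat as ℕ using (ℕ; zero; suc; z≤n; s≤s)
import Data.Nat.Properties as ℕ
open import Data.Product using (_×_; _,_; proj₁; proj₂; Σ; ∃; ∃₂)
open import Data.Rational using (ℚ; 0ℚ; 1ℚ; _+_; _*_; _-_; -_; _≤_; _<_; _/_; 1/_; _⊓_; toℚᵘ; positive; nonNegative)
open import Data.Rational.Properties hiding (_≟_)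
open import Data.Rational.Properties using () renaming (_≟_ to _≟ℚ_)
open import Data.Rational.Solver using (module +-*-Solver)
import Data.Rational.Unnormalised as ℚᵘ
import Data.Rational.Unnormalised.Properties as ℚᵘ
open import Data.Sum using (_⊎_; inj₁; inj₂; map₂)
open import Data.Unit using (⊤; tt)
open import Function using (_∘_; Surjective)
open import Function.Bundles using (_⇔_; mk⇔)
open import Relation.Nullary using (¬_; Dec; yes; no; does)
open import Relation.Nullary.Decidable using (dec-true; dec-false; toWitness; _⊎-dec_; _×-dec_; ¬?)
open import Relation.Unary using (Decidable)
open import Relation.Binary.PropositionalEquality using (_≡_; _≢_; refl; sym; trans; cong; cong₂; subst; subst₂; module ≡-Reasoning)
open import Algebra.Properties.CommutativeSemigroup ℕ.+-commutativeSemigroup using () renaming (interchange to ℕ-interchange)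
open import Algebra.Properties.Group +-0-group using () renaming (∙-cancelˡ to +-cancelˡ)
open import Defs

open +-*-Solver

does⇒ : ∀ {A : Set} (a? : Dec A) → does a? ≡ true → A
does⇒ (yes a) _ = a

bool-ext : ∀ {b c : Bool} → (b ≡ true → c ≡ true) → (c ≡ true → b ≡ true) → b ≡ c
bool-ext {true}  {true}  _ _ = refl
bool-ext {true}  {false} f _ = sym (f refl)
bool-ext {false} {true}  _ g = g refl
bool-ext {false} {false} _ _ = refl

∧-elim : ∀ {a b : Bool} → a ∧ b ≡ true → a ≡ true × b ≡ true
∧-elim {true} {true} _ = refl , refl

∧-intro : ∀ {a b : Bool} → a ≡ true → b ≡ true → a ∧ b ≡ true
∧-intro refl refl = refl

∨-elim : ∀ {a b : Bool} → a ∨ b ≡ true → a ≡ true ⊎ b ≡ true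
∨-elim {true}  _ = inj₁ refl
∨-elim {false} h = inj₂ h

∨-introˡ : ∀ {a b : Bool} → a ≡ true → a ∨ b ≡ true
∨-introˡ refl = refl

∨-introʳ : ∀ {a b : Bool} → b ≡ true → a ∨ b ≡ true
∨-introʳ {true}  _ = refl
∨-introʳ {false} h = h

not-elim : ∀ {b : Bool} → not b ≡ true → b ≡ false
not-elim {false} _ = refl

not-intro : ∀ {b : Bool} → b ≡ false → not b ≡ true
not-intro refl = refl

true≢false : true ≢ false
true≢false ()

infix 4 _==_

_==_ : ∀ {k} → Fin k → Fin k → Bool
i == j = does (i ≟ j)

==⇒≡ : ∀ {k} {i j : Fin k} → (i == j) ≡ true → i ≡ j
==⇒≡ {i = i} {j} = does⇒ (i ≟ j)

≡⇒== : ∀ {k} {i j : Fin k} → i ≡ j → (i == j) ≡ true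
≡⇒== {i = i} {j} = dec-true (i ≟ j)

≢⇒== : ∀ {k} {i j : Fin k} → i ≢ j → (i == j) ≡ false
≢⇒== {i = i} {j} = dec-false (i ≟ j)

==-refl : ∀ {k} (i : Fin k) → (i == i) ≡ true
==-refl i = ≡⇒== {i = i} refl

==⇒≢ : ∀ {k} {i j : Fin k} → (i == j) ≡ false → i ≢ j
==⇒≢ {i = i} h refl = true≢false (trans (sym (==-refl i)) h)

count : ∀ {k} → (Fin k → Bool) → ℕ
count {zero}  f = 0
count {suc k} f = (if f zero then 1 else 0) ℕ.+ count (f ∘ suc)

count-cong : ∀ {k} (f g : Fin k → Bool) → (∀ i → f i ≡ g i) → count f ≡ count g
count-cong {zero}  f g f≗g = refl
count-cong {suc k} f g f≗g =
  cong₂ (λ b c → (if b then 1 else 0) ℕ.+ c) (f≗g zero) (count-cong (f ∘ suc) (g ∘ suc) (f≗g ∘ suc))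

count-true : ∀ k → count {k} (λ _ → true) ≡ k
count-true zero    = refl
count-true (suc k) = cong suc (count-true k)

count-false : ∀ k → count {k} (λ _ → false) ≡ 0
count-false zero    = refl
count-false (suc k) = count-false k

count-pos : ∀ {k} (f : Fin k → Bool) (i : Fin k) → f i ≡ true → 1 ℕ.≤ count f
count-pos f zero    fi rewrite fi = s≤s z≤n
count-pos f (suc i) fi = ℕ.≤-trans (count-pos (f ∘ suc) i fi) (ℕ.m≤n+m _ _)

count-single : ∀ {k} (i : Fin k) → count (_== i) ≡ 1
count-single {suc k} zero    = cong suc (count-false k)
count-single {suc k} (suc i) = count-single i

count-remove : ∀ {k} (f : Fin k → Bool) (i : Fin k) → f i ≡ true →
  suc (count (λ j → f j ∧ not (j == i))) ≡ count f
count-remove f zero fi rewrite fi =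
  cong suc (count-cong _ _ (λ j → ∧-identityʳ (f (suc j))))
count-remove f (suc i) fi with f zero
... | true  = cong suc (count-remove (f ∘ suc) i fi)
... | false = count-remove (f ∘ suc) i fi

count≤1 : ∀ {k} (f : Fin k → Bool) → (∀ i j → f i ≡ true → f j ≡ true → i ≡ j) → count f ℕ.≤ 1
count≤1 {zero}  f unique = z≤n
count≤1 {suc k} f unique with f zero in f0
... | true  = ℕ.≤-reflexive (cong suc (trans (count-cong (f ∘ suc) _ rest-false) (count-false k)))
  where
  rest-false : ∀ i → f (suc i) ≡ false
  rest-false i with f (suc i) in fi
  ... | true  with () ← unique zero (suc i) f0 fi
  ... | false = refl
... | false = count≤1 (f ∘ suc) (λ i j fi fj → suc-injective (unique _ _ fi fj))

count-∨-∧ : ∀ {k} (f g : Fin k → Bool) →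
  count (λ i → f i ∨ g i) ℕ.+ count (λ i → f i ∧ g i) ≡ count f ℕ.+ count g
count-∨-∧ {zero}  f g = refl
count-∨-∧ {suc k} f g = begin
  (A ℕ.+ X) ℕ.+ (B ℕ.+ Y) ≡⟨ ℕ-interchange A X B Y ⟩
  (A ℕ.+ B) ℕ.+ (X ℕ.+ Y) ≡⟨ cong₂ ℕ._+_ (pointwise (f zero) (g zero)) (count-∨-∧ (f ∘ suc) (g ∘ suc)) ⟩
  (C ℕ.+ D) ℕ.+ (U ℕ.+ W) ≡⟨ ℕ-interchange C D U W ⟩
  (C ℕ.+ U) ℕ.+ (D ℕ.+ W) ∎
  where
  open ≡-Reasoning
  [_] : Bool → ℕ
  [ b ] = if b then 1 else 0
  pointwise : ∀ a b → [ a ∨ b ] ℕ.+ [ a ∧ b ] ≡ [ a ] ℕ.+ [ b ]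
  pointwise true  true  = refl
  pointwise true  false = refl
  pointwise false true  = refl
  pointwise false false = refl
  A = [ f zero ∨ g zero ]
  B = [ f zero ∧ g zero ]
  X = count (λ i → f (suc i) ∨ g (suc i))
  Y = count (λ i → f (suc i) ∧ g (suc i))
  C = [ f zero ]
  D = [ g zero ]
  U = count (f ∘ suc)
  W = count (g ∘ suc)

image : ∀ {n K} → (Fin n → Fin K) → Fin K → Bool
image lab y = does (any? λ x → lab x ≟ y)

image-intro : ∀ {n K} (lab : Fin n → Fin K) {x y} → lab x ≡ y → image lab y ≡ true
image-intro lab {x} {y} lx≡y = dec-true (any? λ z → lab z ≟ y) (x , lx≡y)

image-elim : ∀ {n K} (lab : Fin n → Fin K) {y} → image lab y ≡ true → ∃ λ x → lab x ≡ y
image-elim lab {y} = does⇒ (any? λ x → lab x ≟ y)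

image-cong : ∀ {n K} (f g : Fin n → Fin K) → (∀ x → f x ≡ g x) → ∀ y → image f y ≡ image g y
image-cong f g f≗g y = bool-ext
  (λ h → let (x , fx≡y) = image-elim f h in image-intro g (trans (sym (f≗g x)) fx≡y))
  (λ h → let (x , gx≡y) = image-elim g h in image-intro f (trans (f≗g x) gx≡y))

count-image-surjective : ∀ {n K} (lab : Fin n → Fin K) → Surjective _≡_ _≡_ lab → count (image lab) ≡ K
count-image-surjective {K = K} lab sur =
  trans (count-cong _ _ (λ y → image-intro lab (proj₂ (sur y) refl))) (count-true K)

merge : ∀ {n K} → (Fin n → Fin K) → Fin K → Fin K → Fin n → Fin K
merge lab A B x = if lab x == B then A else lab x

module _ {n K} (lab : Fin n → Fin K) (A B : Fin K) where

  merge-B : ∀ {x} → lab x ≡ B → merge lab A B x ≡ A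
  merge-B {x} lx≡B rewrite ≡⇒== lx≡B = refl

  merge-A : ∀ {x} → lab x ≡ A → merge lab A B x ≡ A
  merge-A {x} lx≡A with lab x == B
  ... | true  = refl
  ... | false = lx≡A

  merge-other : ∀ {x} → lab x ≢ B → merge lab A B x ≡ lab x
  merge-other lx≢B rewrite ≢⇒== lx≢B = refl

  merge-cong : ∀ {x y} → lab x ≡ lab y → merge lab A B x ≡ merge lab A B y
  merge-cong = cong λ l → if l == B then A else l

  merge-inv : ∀ x y → merge lab A B x ≡ merge lab A B y →
    lab x ≡ lab y ⊎ ((lab x ≡ A ⊎ lab x ≡ B) × (lab y ≡ A ⊎ lab y ≡ B))
  merge-inv x y h with lab x == B in ex | lab y == B in ey
  ... | true  | true  = inj₁ (trans (==⇒≡ ex) (sym (==⇒≡ ey)))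
  ... | true  | false = inj₂ (inj₂ (==⇒≡ ex) , inj₁ (sym h))
  ... | false | true  = inj₂ (inj₁ h , inj₂ (==⇒≡ ey))
  ... | false | false = inj₁ h

  image-merge : A ≢ B → image lab A ≡ true → ∀ y → image (merge lab A B) y ≡ image lab y ∧ not (y == B)
  image-merge A≢B A∈ y = bool-ext to from
    where
    to : image (merge lab A B) y ≡ true → image lab y ∧ not (y == B) ≡ true
    to h with image-elim (merge lab A B) h
    ... | x , mx≡y with lab x ≟ B
    ...   | yes _    = subst (λ z → image lab z ∧ not (z == B) ≡ true) mx≡y (∧-intro A∈ (not-intro (≢⇒== A≢B)))
    ...   | no lx≢B  = ∧-intro (image-intro lab mx≡y) (not-intro (≢⇒== λ y≡B → lx≢B (trans mx≡y y≡B)))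
    from : image lab y ∧ not (y == B) ≡ true → image (merge lab A B) y ≡ true
    from h with ∧-elim h
    ... | y∈ , y≢B with image-elim lab y∈
    ...   | x , lx≡y = image-intro (merge lab A B)
                         (trans (merge-other λ lx≡B → ==⇒≢ (not-elim y≢B) (trans (sym lx≡y) lx≡B)) lx≡y)

  count-image-merge : A ≢ B → image lab A ≡ true → image lab B ≡ true →
    suc (count (image (merge lab A B))) ≡ count (image lab)
  count-image-merge A≢B A∈ B∈ =
    trans (cong suc (count-cong _ _ (image-merge A≢B A∈))) (count-remove (image lab) B B∈)

count-image-merge-≥ : ∀ {n K} (lab : Fin n → Fin K) a b →
  count (image lab) ℕ.≤ suc (count (image (merge lab (lab a) (lab b))))
count-image-merge-≥ lab a b with lab a ≟ lab b
... | yes la≡lb = ℕ.≤-trans (ℕ.≤-reflexive (count-cong _ _ (image-cong lab _ unchanged))) (ℕ.n≤1+n _)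
  where
  unchanged : ∀ x → lab x ≡ merge lab (lab a) (lab b) x
  unchanged x with lab x ≟ lab b
  ... | yes lx≡lb = trans lx≡lb (sym la≡lb)
  ... | no  _     = refl
... | no la≢lb = ℕ.≤-reflexive (sym (count-image-merge lab (lab a) (lab b) la≢lb (image-intro lab refl) (image-intro lab refl)))

SameKernel : ∀ {n K L} → (Fin n → Fin K) → (Fin n → Fin L) → Set
SameKernel f g = (∀ u v → f u ≡ f v → g u ≡ g v) × (∀ u v → g u ≡ g v → f u ≡ f v)

-- Values outside the image are deleted one at a time with punchOut.
compress : ∀ {n} N (f : Fin n → Fin N) → ∃₂ λ k (g : Fin n → Fin k) → Surjective _≡_ _≡_ g × SameKernel f g
compress zero f = 0 , f , (λ ()) , (λ _ _ h → h) , (λ _ _ h → h)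
compress (suc N) f with all? (λ y → any? λ x → f x ≟ y)
... | yes hit = suc N , f , (λ y → let (x , fx≡y) = hit y in x , λ { refl → fx≡y }) , (λ _ _ h → h) , (λ _ _ h → h)
... | no ¬hit = skip (¬∀⟶∃¬ (suc N) _ (λ y → any? λ x → f x ≟ y) ¬hit)
  where
  skip : (∃ λ y → ¬ ∃ λ x → f x ≡ y) → ∃₂ λ k (g : Fin _ → Fin k) → Surjective _≡_ _≡_ g × SameKernel f g
  skip (y , missed) =
    let (k , g , sur , to , from) = compress N (λ x → punchOut (avoid x)) in
    k , g , sur , (λ u v fu≡fv → to u v (punchOut-cong y fu≡fv))
                , (λ u v gu≡gv → punchOut-injective (avoid u) (avoid v) (from u v gu≡gv))
    where
    avoid : ∀ x → y ≢ f x
    avoid x y≡fx = missed (x , sym y≡fx)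

module Graph {n m : ℕ} (ends : Fin m → Fin n × Fin n) where

  src tgt : Fin m → Fin n
  src = proj₁ ∘ ends
  tgt = proj₂ ∘ ends

  Path : (Fin m → Set) → Fin n → Fin n → Set
  Path = Reach ends (λ _ → ⊤)

  module _ {S : Fin m → Set} where

    path-trans : ∀ {a b c} → Path S a b → Path S b c → Path S a c
    path-trans here                q = q
    path-trans (stepˡ e e∈ _ _ p) q = stepˡ e e∈ tt tt (path-trans p q)
    path-trans (stepʳ e e∈ _ _ p) q = stepʳ e e∈ tt tt (path-trans p q)

    path-edge : ∀ e → S e → Path S (src e) (tgt e)
    path-edge e e∈ = stepˡ e e∈ tt tt here

    path-edge˘ : ∀ e → S e → Path S (tgt e) (src e)
    path-edge˘ e e∈ = stepʳ e e∈ tt tt here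

    path-sym : ∀ {a b} → Path S a b → Path S b a
    path-sym here                = here
    path-sym (stepˡ e e∈ _ _ p) = path-trans (path-sym p) (path-edge˘ e e∈)
    path-sym (stepʳ e e∈ _ _ p) = path-trans (path-sym p) (path-edge e e∈)

    path-preserves : (X : Fin n → Set) → (∀ e → S e → X (src e) → X (tgt e)) → (∀ e → S e → X (tgt e) → X (src e)) →
      ∀ {a b} → Path S a b → X a → X b
    path-preserves X fw bw here                xa = xa
    path-preserves X fw bw (stepˡ e e∈ _ _ p) xa = path-preserves X fw bw p (fw e e∈ xa)
    path-preserves X fw bw (stepʳ e e∈ _ _ p) xa = path-preserves X fw bw p (bw e e∈ xa)

    path-restrict : (X : Fin n → Set) → (∀ e → S e → X (src e) → X (tgt e)) → (∀ e → S e → X (tgt e) → X (src e)) →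
      ∀ {a b} → Path S a b → X a → Reach ends X S a b
    path-restrict X fw bw here                xa = here
    path-restrict X fw bw (stepˡ e e∈ _ _ p) xa = stepˡ e e∈ xa (fw e e∈ xa) (path-restrict X fw bw p (fw e e∈ xa))
    path-restrict X fw bw (stepʳ e e∈ _ _ p) xa = stepʳ e e∈ (bw e e∈ xa) xa (path-restrict X fw bw p (bw e e∈ xa))

    path-crossing : (X : Fin n → Set) → Decidable X → ∀ {a b} → Path S a b → X a → ¬ X b →
      ∃ λ e → S e × ((X (src e) × ¬ X (tgt e)) ⊎ (¬ X (src e) × X (tgt e)))
    path-crossing X X? here xa ¬xb = ⊥-elim (¬xb xa)
    path-crossing X X? (stepˡ e e∈ _ _ p) xa ¬xb with X? (tgt e)
    ... | yes xt = path-crossing X X? p xt ¬xb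
    ... | no ¬xt = e , e∈ , inj₁ (xa , ¬xt)
    path-crossing X X? (stepʳ e e∈ _ _ p) xa ¬xb with X? (src e)
    ... | yes xs = path-crossing X X? p xs ¬xb
    ... | no ¬xs = e , e∈ , inj₂ (¬xs , xa)

  path-bind : ∀ {S S′} → (∀ e → S e → Path S′ (src e) (tgt e)) → ∀ {a b} → Path S a b → Path S′ a b
  path-bind route here                = here
  path-bind route (stepˡ e e∈ _ _ p) = path-trans (route e e∈) (path-bind route p)
  path-bind route (stepʳ e e∈ _ _ p) = path-trans (path-sym (route e e∈)) (path-bind route p)

  path-mono : ∀ {S S′} → (∀ e → S e → S′ e) → ∀ {a b} → Path S a b → Path S′ a b
  path-mono S⊆S′ = path-bind λ e e∈ → path-edge e (S⊆S′ e e∈)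

  path-split : ∀ {S S′} f → (∀ e → S′ e → S e ⊎ e ≡ f) → ∀ {a b} → Path S′ a b →
    Path S a b ⊎ (Path S a (src f) × Path S (tgt f) b) ⊎ (Path S a (tgt f) × Path S (src f) b)
  path-split f S′⊆S+f here = inj₁ here
  path-split f S′⊆S+f (stepˡ e e∈ _ _ p) with S′⊆S+f e e∈ | path-split f S′⊆S+f p
  ... | inj₁ e∈S | inj₁ q                = inj₁ (stepˡ e e∈S tt tt q)
  ... | inj₁ e∈S | inj₂ (inj₁ (q₁ , q₂)) = inj₂ (inj₁ (stepˡ e e∈S tt tt q₁ , q₂))
  ... | inj₁ e∈S | inj₂ (inj₂ (q₁ , q₂)) = inj₂ (inj₂ (stepˡ e e∈S tt tt q₁ , q₂))
  ... | inj₂ refl | inj₁ q                = inj₂ (inj₁ (here , q))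
  ... | inj₂ refl | inj₂ (inj₁ (_ , q₂))  = inj₂ (inj₁ (here , q₂))
  ... | inj₂ refl | inj₂ (inj₂ (_ , q₂))  = inj₁ q₂
  path-split f S′⊆S+f (stepʳ e e∈ _ _ p) with S′⊆S+f e e∈ | path-split f S′⊆S+f p
  ... | inj₁ e∈S | inj₁ q                = inj₁ (stepʳ e e∈S tt tt q)
  ... | inj₁ e∈S | inj₂ (inj₁ (q₁ , q₂)) = inj₂ (inj₁ (stepʳ e e∈S tt tt q₁ , q₂))
  ... | inj₁ e∈S | inj₂ (inj₂ (q₁ , q₂)) = inj₂ (inj₂ (stepʳ e e∈S tt tt q₁ , q₂))
  ... | inj₂ refl | inj₁ q                = inj₂ (inj₂ (here , q))
  ... | inj₂ refl | inj₂ (inj₁ (_ , q₂))  = inj₁ q₂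
  ... | inj₂ refl | inj₂ (inj₂ (_ , q₂))  = inj₂ (inj₂ (here , q₂))

  reach⇒path : ∀ {W S a b} → Reach ends W S a b → Path (λ e → S e × W (src e) × W (tgt e)) a b
  reach⇒path here                     = here
  reach⇒path (stepˡ e e∈ ws wt p) = stepˡ e (e∈ , ws , wt) tt tt (reach⇒path p)
  reach⇒path (stepʳ e e∈ ws wt p) = stepʳ e (e∈ , ws , wt) tt tt (reach⇒path p)

  path⇒reach : ∀ {W S a b} → Path (λ e → S e × W (src e) × W (tgt e)) a b → Reach ends W S a b
  path⇒reach here                            = here
  path⇒reach (stepˡ e (e∈ , ws , wt) _ _ p) = stepˡ e e∈ ws wt (path⇒reach p)
  path⇒reach (stepʳ e (e∈ , ws , wt) _ _ p) = stepʳ e e∈ ws wt (path⇒reach p)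

  Joins : Fin m → Fin n → Fin n → Set
  Joins e x y = (src e ≡ x × tgt e ≡ y) ⊎ (src e ≡ y × tgt e ≡ x)

  joins-to : ∀ {S e x y} → Joins e x y → Path S x y → Path S (src e) (tgt e)
  joins-to (inj₁ (refl , refl)) path = path
  joins-to (inj₂ (refl , refl)) path = path-sym path

  joins-from : ∀ {S e x y} → Joins e x y → Path S (src e) (tgt e) → Path S x y
  joins-from (inj₁ (refl , refl)) path = path
  joins-from (inj₂ (refl , refl)) path = path-sym path

  In : (Fin m → Bool) → Fin m → Set
  In F e = F e ≡ true

  Without : (Fin m → Bool) → Fin m → Fin m → Set
  Without F e f = In F f × f ≢ e

  Acyclic : (Fin m → Bool) → Set
  Acyclic F = ∀ e → In F e → ¬ Path (Without F e) (src e) (tgt e)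

  SpansGraph : (Fin m → Bool) → Set
  SpansGraph F = ∀ u v → Path (In F) u v

  merge-along-edge : ∀ {K S} (lab : Fin n → Fin K) e → S e → (∀ u v → lab u ≡ lab v → Path S u v) →
    ∀ u v → merge lab (lab (src e)) (lab (tgt e)) u ≡ merge lab (lab (src e)) (lab (tgt e)) v → Path S u v
  merge-along-edge {S = S} lab e e∈ label⇒path u v h with merge-inv lab (lab (src e)) (lab (tgt e)) u v h
  ... | inj₁ same          = label⇒path u v same
  ... | inj₂ (u∈AB , v∈AB) = path-trans (to-src u u∈AB) (path-sym (to-src v v∈AB))
    where
    to-src : ∀ w → (lab w ≡ lab (src e) ⊎ lab w ≡ lab (tgt e)) → Path S w (src e)
    to-src w (inj₁ w∼s) = label⇒path w (src e) w∼s
    to-src w (inj₂ w∼t) = path-trans (label⇒path w (tgt e) w∼t) (path-edge˘ e e∈)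

  reach-mono : ∀ {W S S′} → (∀ e → S e → S′ e) → ∀ {a b} → Reach ends W S a b → Reach ends W S′ a b
  reach-mono S⊆S′ here                    = here
  reach-mono S⊆S′ (stepˡ e e∈ ws wt p) = stepˡ e (S⊆S′ e e∈) ws wt (reach-mono S⊆S′ p)
  reach-mono S⊆S′ (stepʳ e e∈ ws wt p) = stepʳ e (S⊆S′ e e∈) ws wt (reach-mono S⊆S′ p)

-- Kruskal's algorithm

module Kruskal {n m : ℕ} (ends : Fin m → Fin n × Fin n) where
  open Graph ends

  record LabelledForest : Set where
    field
      edges      : Fin m → Bool
      label      : Fin n → Fin n
      label⇒path : ∀ u v → label u ≡ label v → Path (In edges) u v
      path⇒label : ∀ u v → Path (In edges) u v → label u ≡ label v
      acyclic    : Acyclic edges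

  open LabelledForest public

  emptyForest : LabelledForest
  emptyForest = record
    { edges = λ _ → false ; label = λ x → x
    ; label⇒path = λ { u .u refl → here } ; path⇒label = λ u v → no-edges ; acyclic = λ _ () }
    where
    no-edges : ∀ {u v} → Path (In λ _ → false) u v → u ≡ v
    no-edges here = refl

  addEdge : (Fin m → Bool) → Fin m → Fin m → Bool
  addEdge F g e = F e ∨ (e == g)

  addEdge-new : ∀ F g → In (addEdge F g) g
  addEdge-new F g = ∨-introʳ {F g} (==-refl g)

  addEdge-old : ∀ F g {e} → In F e → In (addEdge F g) e
  addEdge-old F g = ∨-introˡ

  addEdge-elim : ∀ F g {e} → In (addEdge F g) e → In F e ⊎ e ≡ g
  addEdge-elim F g {e} h with ∨-elim {F e} h
  ... | inj₁ e∈F  = inj₁ e∈F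
  ... | inj₂ e==g = inj₂ (==⇒≡ e==g)

  module Insert (φ : LabelledForest) (g : Fin m) (separated : label φ (src g) ≢ label φ (tgt g)) where

    A B : Fin n
    A = label φ (src g)
    B = label φ (tgt g)

    F′ : Fin m → Bool
    F′ = addEdge (edges φ) g

    label′ : Fin n → Fin n
    label′ = merge (label φ) A B

    label′⇒path : ∀ u v → label′ u ≡ label′ v → Path (In F′) u v
    label′⇒path = merge-along-edge (label φ) g (addEdge-new (edges φ) g)
      λ u v same → path-mono (λ e → addEdge-old (edges φ) g) (label⇒path φ u v same)

    edge⇒label′ : ∀ e → In F′ e → label′ (src e) ≡ label′ (tgt e)
    edge⇒label′ e e∈ with addEdge-elim (edges φ) g e∈
    ... | inj₁ e∈F = merge-cong (label φ) A B (path⇒label φ _ _ (path-edge e e∈F))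
    ... | inj₂ refl = trans (merge-A (label φ) A B refl) (sym (merge-B (label φ) A B refl))

    path⇒label′ : ∀ u v → Path (In F′) u v → label′ u ≡ label′ v
    path⇒label′ u v p = sym (path-preserves (λ w → label′ w ≡ label′ u)
      (λ e e∈ q → trans (sym (edge⇒label′ e e∈)) q) (λ e e∈ q → trans (edge⇒label′ e e∈) q) p refl)

    forget : ∀ {e a b} → Path (Without (edges φ) e) a b → Path (In (edges φ)) a b
    forget = path-mono λ _ → proj₁

    -- A cycle through g would join the ends of g in φ; a cycle through an old
    -- edge e avoiding g is a cycle of φ, and one using g makes e join the ends of g.
    acyclic′ : Acyclic F′
    acyclic′ e e∈ p with addEdge-elim (edges φ) g e∈
    ... | inj₂ refl = separated (path⇒label φ _ _ (path-mono old p))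
      where
      old : ∀ f → Without F′ g f → In (edges φ) f
      old f (f∈ , f≢g) with addEdge-elim (edges φ) g f∈
      ... | inj₁ f∈F = f∈F
      ... | inj₂ f≡g = ⊥-elim (f≢g f≡g)
    ... | inj₁ e∈F with path-split g split p
      where
      split : ∀ f → Without F′ e f → Without (edges φ) e f ⊎ f ≡ g
      split f (f∈ , f≢e) with addEdge-elim (edges φ) g f∈
      ... | inj₁ f∈F = inj₁ (f∈F , f≢e)
      ... | inj₂ f≡g = inj₂ f≡g
    ...   | inj₁ q = acyclic φ e e∈F q
    ...   | inj₂ (inj₁ (q₁ , q₂)) = separated (path⇒label φ _ _
              (path-trans (path-sym (forget q₁)) (path-trans (path-edge e e∈F) (path-sym (forget q₂)))))
    ...   | inj₂ (inj₂ (q₁ , q₂)) = separated (path⇒label φ _ _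
              (path-trans (forget q₂) (path-trans (path-edge˘ e e∈F) (forget q₁))))

    forest : LabelledForest
    forest = record { edges = F′ ; label = label′ ; label⇒path = label′⇒path
                    ; path⇒label = path⇒label′ ; acyclic = acyclic′ }

  module _ {P : Fin m → Set} (P? : Decidable P) where

    step : LabelledForest → Fin m → LabelledForest
    step φ g with P? g | label φ (src g) ≟ label φ (tgt g)
    ... | yes _ | no separated = Insert.forest φ g separated
    ... | _     | _            = φ

    step-⊇ : ∀ φ g {e} → In (edges φ) e → In (edges (step φ g)) e
    step-⊇ φ g e∈ with P? g | label φ (src g) ≟ label φ (tgt g)
    ... | yes _ | no _  = addEdge-old (edges φ) g e∈
    ... | yes _ | yes _ = e∈
    ... | no _  | _     = e∈

    step-⊆ : ∀ φ g {e} → In (edges (step φ g)) e → In (edges φ) e ⊎ P e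
    step-⊆ φ g e∈ with P? g | label φ (src g) ≟ label φ (tgt g)
    ... | yes Pg | no _ with addEdge-elim (edges φ) g e∈
    ...   | inj₁ e∈F = inj₁ e∈F
    ...   | inj₂ refl = inj₂ Pg
    step-⊆ φ g e∈ | yes _ | yes _ = inj₁ e∈
    step-⊆ φ g e∈ | no _  | _     = inj₁ e∈

    step-connects : ∀ φ g → P g → Path (In (edges (step φ g))) (src g) (tgt g)
    step-connects φ g Pg with P? g | label φ (src g) ≟ label φ (tgt g)
    ... | yes _ | no _     = path-edge g (addEdge-new (edges φ) g)
    ... | yes _ | yes same = label⇒path φ _ _ same
    ... | no ¬Pg | _       = ⊥-elim (¬Pg Pg)

    growAlong : LabelledForest → List (Fin m) → LabelledForest
    growAlong φ []       = φ
    growAlong φ (g ∷ gs) = growAlong (step φ g) gs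

    growAlong-⊇ : ∀ φ gs {e} → In (edges φ) e → In (edges (growAlong φ gs)) e
    growAlong-⊇ φ []       e∈ = e∈
    growAlong-⊇ φ (g ∷ gs) e∈ = growAlong-⊇ (step φ g) gs (step-⊇ φ g e∈)

    growAlong-⊆ : ∀ φ gs {e} → In (edges (growAlong φ gs)) e → In (edges φ) e ⊎ P e
    growAlong-⊆ φ []       e∈ = inj₁ e∈
    growAlong-⊆ φ (g ∷ gs) e∈ with growAlong-⊆ (step φ g) gs e∈
    ... | inj₁ e∈step = step-⊆ φ g e∈step
    ... | inj₂ Pe     = inj₂ Pe

    growAlong-connects : ∀ φ gs g → g ∈ gs → P g → Path (In (edges (growAlong φ gs))) (src g) (tgt g)
    growAlong-connects φ (g ∷ gs) g (here refl) Pg = path-mono (λ _ → growAlong-⊇ (step φ g) gs) (step-connects φ g Pg)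
    growAlong-connects φ (h ∷ gs) g (there g∈) Pg = growAlong-connects (step φ h) gs g g∈ Pg

    grow : LabelledForest → LabelledForest
    grow φ = growAlong φ (allFin m)

    grow-⊇ : ∀ φ {e} → In (edges φ) e → In (edges (grow φ)) e
    grow-⊇ φ = growAlong-⊇ φ (allFin m)

    grow-⊆ : ∀ φ {e} → In (edges (grow φ)) e → In (edges φ) e ⊎ P e
    grow-⊆ φ = growAlong-⊆ φ (allFin m)

    grow-connects : ∀ φ {u v} → Path P u v → Path (In (edges (grow φ))) u v
    grow-connects φ = path-bind λ g Pg → growAlong-connects φ (allFin m) g (∈-allFin g) Pg

  grow-spanningTree : Connected ends → ∀ φ → IsSpanningTree ends (edges (grow (λ _ → yes tt) φ))
  grow-spanningTree connected φ = (λ u v → grow-connects (λ _ → yes tt) φ (connected u v)) , acyclic (grow _ φ)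

  grow-forces : ∀ φ e → ¬ Path (In (edges φ)) (src e) (tgt e) → In (edges (grow (_≟ e) φ)) e
  grow-forces φ e apart with edges (grow (_≟ e) φ) e in e∈?
  ... | true  = refl
  ... | false = ⊥-elim (apart (path-mono old (grow-connects (_≟ e) φ (path-edge e refl))))
    where
    old : ∀ f → In (edges (grow (_≟ e) φ)) f → In (edges φ) f
    old f f∈ with grow-⊆ (_≟ e) φ f∈
    ... | inj₁ f∈φ = f∈φ
    ... | inj₂ refl = ⊥-elim (true≢false (trans (sym f∈) e∈?))

-- Counting cut edges

countAlong : ∀ {m} → (Fin m → Bool) → List (Fin m) → ℕ
countAlong h []       = 0
countAlong h (e ∷ es) = (if h e then 1 else 0) ℕ.+ countAlong h es

countAlong-allFin : ∀ {m} (h : Fin m → Bool) → countAlong h (allFin m) ≡ count h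
countAlong-allFin h = tabulated h (λ i → i)
  where
  tabulated : ∀ {k m} (h : Fin m → Bool) (g : Fin k → Fin m) → countAlong h (tabulate g) ≡ count (h ∘ g)
  tabulated {zero}  h g = refl
  tabulated {suc k} h g = cong ((if h (g zero) then 1 else 0) ℕ.+_) (tabulated h (g ∘ suc))

module CutCount {n m K : ℕ} (ends : Fin m → Fin n × Fin n) (q : Fin n → Fin K) where
  open Graph ends

  Internal : Fin m → Set
  Internal e = q (src e) ≡ q (tgt e)

  isCut : Fin m → Bool
  isCut e = not (q (src e) == q (tgt e))

  cutEdges : (Fin m → Bool) → Fin m → Bool
  cutEdges T e = T e ∧ isCut e

  Coarser : (Fin n → Fin K) → Set
  Coarser lab = ∀ u v → q u ≡ q v → lab u ≡ lab v

  -- Both bounds below come from merging the labels of q along the cut edges of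
  -- T one at a time: each merge removes at most one label.
  mergeCut : (Fin m → Bool) → Fin m → (Fin n → Fin K) → Fin n → Fin K
  mergeCut T e lab = if cutEdges T e then merge lab (lab (src e)) (lab (tgt e)) else lab

  mergeAlong : (Fin m → Bool) → List (Fin m) → (Fin n → Fin K) → Fin n → Fin K
  mergeAlong T []       lab = lab
  mergeAlong T (e ∷ es) lab = mergeAlong T es (mergeCut T e lab)

  module _ (T : Fin m → Bool) where

    mergeCut-cong : ∀ e lab {u v} → lab u ≡ lab v → mergeCut T e lab u ≡ mergeCut T e lab v
    mergeCut-cong e lab with cutEdges T e
    ... | true  = merge-cong lab _ _
    ... | false = λ h → h

    mergeAlong-cong : ∀ es lab {u v} → lab u ≡ lab v → mergeAlong T es lab u ≡ mergeAlong T es lab v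
    mergeAlong-cong []       lab h = h
    mergeAlong-cong (e ∷ es) lab h = mergeAlong-cong es (mergeCut T e lab) (mergeCut-cong e lab h)

    mergeCut-joins : ∀ e lab → Coarser lab → In T e → mergeCut T e lab (src e) ≡ mergeCut T e lab (tgt e)
    mergeCut-joins e lab coarser e∈T with q (src e) == q (tgt e) in internal?
    ... | true  rewrite e∈T = coarser _ _ (==⇒≡ internal?)
    ... | false rewrite e∈T = trans (merge-A lab _ _ refl) (sym (merge-B lab _ _ refl))

    mergeAlong-joins : ∀ es lab → Coarser lab → ∀ e → e ∈ es → In T e →
      mergeAlong T es lab (src e) ≡ mergeAlong T es lab (tgt e)
    mergeAlong-joins (e ∷ es) lab coarser .e (here refl) e∈T =
      mergeAlong-cong es (mergeCut T e lab) (mergeCut-joins e lab coarser e∈T)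
    mergeAlong-joins (f ∷ es) lab coarser e (there e∈es) e∈T =
      mergeAlong-joins es (mergeCut T f lab) (λ u v h → mergeCut-cong f lab (coarser u v h)) e e∈es e∈T

    mergeCut-count : ∀ e lab → count (image lab) ℕ.≤ (if cutEdges T e then 1 else 0) ℕ.+ count (image (mergeCut T e lab))
    mergeCut-count e lab with cutEdges T e
    ... | true  = count-image-merge-≥ lab (src e) (tgt e)
    ... | false = ℕ.≤-refl

    mergeAlong-count : ∀ es lab → count (image lab) ℕ.≤ countAlong (cutEdges T) es ℕ.+ count (image (mergeAlong T es lab))
    mergeAlong-count []       lab = ℕ.≤-refl
    mergeAlong-count (e ∷ es) lab = begin
      count (image lab)                              ≤⟨ mergeCut-count e lab ⟩
      [e] ℕ.+ count (image (mergeCut T e lab))       ≤⟨ ℕ.+-monoʳ-≤ [e] (mergeAlong-count es (mergeCut T e lab)) ⟩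
      [e] ℕ.+ (countAlong (cutEdges T) es ℕ.+ final) ≡⟨ ℕ.+-assoc [e] (countAlong (cutEdges T) es) final ⟨
      countAlong (cutEdges T) (e ∷ es) ℕ.+ final     ∎
      where
      open ℕ.≤-Reasoning
      [e] = if cutEdges T e then 1 else 0
      final = count (image (mergeAlong T (e ∷ es) lab))

  parts≤1+cutEdges : (T : Fin m → Bool) → SpansGraph T → count (image q) ℕ.≤ suc (count (cutEdges T))
  parts≤1+cutEdges T spans = begin
    count (image q)                                            ≤⟨ mergeAlong-count T (allFin m) q ⟩
    countAlong (cutEdges T) (allFin m) ℕ.+ count (image final) ≡⟨ cong (ℕ._+ count (image final)) (countAlong-allFin (cutEdges T)) ⟩
    count (cutEdges T) ℕ.+ count (image final)                 ≤⟨ ℕ.+-monoʳ-≤ (count (cutEdges T)) final-constant ⟩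
    count (cutEdges T) ℕ.+ 1                                   ≡⟨ ℕ.+-comm (count (cutEdges T)) 1 ⟩
    suc (count (cutEdges T))                                   ∎
    where
    open ℕ.≤-Reasoning
    final = mergeAlong T (allFin m) q
    joins : ∀ e → In T e → final (src e) ≡ final (tgt e)
    joins e = mergeAlong-joins T (allFin m) q (λ _ _ h → h) e (∈-allFin e)
    constant : ∀ u v → final u ≡ final v
    constant u v = sym (path-preserves (λ w → final w ≡ final u)
      (λ e e∈ h → trans (sym (joins e e∈)) h) (λ e e∈ h → trans (joins e e∈) h) (spans u v) refl)
    final-constant : count (image final) ℕ.≤ 1
    final-constant = count≤1 (image final) λ y z y∈ z∈ →
      let (u , fu≡y) = image-elim final y∈ ; (v , fv≡z) = image-elim final z∈ in
      trans (sym fu≡y) (trans (constant u v) fv≡z)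

  module _ (T : Fin m → Bool) (acyclic : Acyclic T) where

    InternalOr : (Fin m → Set) → Fin m → Set
    InternalOr Done f = In T f × (Internal f ⊎ Done f)

    widen : ∀ {Done e u v} → Path (InternalOr Done) u v → Path (InternalOr λ f → Done f ⊎ f ≡ e) u v
    widen = path-mono λ { f (f∈ , inj₁ i) → f∈ , inj₁ i ; f (f∈ , inj₂ d) → f∈ , inj₂ (inj₁ d) }

    still-pending : ∀ {Done : Fin m → Set} {e es} → All (e ≢_) es → (∀ f → f ∈ e ∷ es → ¬ Done f) →
      ∀ f → f ∈ es → ¬ (Done f ⊎ f ≡ e)
    still-pending e∉es pending f f∈es (inj₁ d)    = pending f (there f∈es) d
    still-pending e∉es pending f f∈es (inj₂ refl) = lookup e∉es f∈es refl

    -- Invariant: equal labels are joined by edges of T that are internal or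
    -- Done; as T is acyclic, each further cut edge of T merges two distinct labels.
    mergeAlong-count-exact : ∀ (Done : Fin m → Set) es lab →
      (∀ u v → lab u ≡ lab v → Path (InternalOr Done) u v) → Unique es → (∀ f → f ∈ es → ¬ Done f) →
      countAlong (cutEdges T) es ℕ.+ count (image (mergeAlong T es lab)) ℕ.≤ count (image lab)
    mergeAlong-count-exact Done []       lab label⇒path _ _ = ℕ.≤-refl
    mergeAlong-count-exact Done (e ∷ es) lab label⇒path (e∉es ∷ unique) pending with cutEdges T e in e-cut
    ... | false = mergeAlong-count-exact _ es lab (λ u v h → widen (label⇒path u v h)) unique
                    (still-pending e∉es pending)
    ... | true = begin
      suc (countAlong (cutEdges T) es ℕ.+ count (image (mergeAlong T es lab′)))
                                            ≤⟨ s≤s (mergeAlong-count-exact _ es lab′ label′⇒path unique (still-pending e∉es pending)) ⟩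
      suc (count (image lab′)) ≡⟨ count-image-merge lab A B A≢B (image-intro lab refl) (image-intro lab refl) ⟩
      count (image lab)        ∎
      where
      open ℕ.≤-Reasoning
      A = lab (src e)
      B = lab (tgt e)
      lab′ = merge lab A B
      e∈T : In T e
      e∈T = proj₁ (∧-elim e-cut)
      A≢B : A ≢ B
      A≢B A≡B = acyclic e e∈T (path-mono avoid-e (label⇒path _ _ A≡B))
        where
        avoid-e : ∀ f → InternalOr Done f → Without T e f
        avoid-e f (f∈ , inj₁ i) = f∈ , λ { refl → ==⇒≢ (not-elim (proj₂ (∧-elim e-cut))) i }
        avoid-e f (f∈ , inj₂ d) = f∈ , λ { refl → pending e (here refl) d }
      label′⇒path : ∀ u v → lab′ u ≡ lab′ v → Path (InternalOr λ f → Done f ⊎ f ≡ e) u v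
      label′⇒path = merge-along-edge lab e (e∈T , inj₂ (inj₂ refl)) λ u v h → widen (label⇒path u v h)

    1+cutEdges≤parts : (∀ u v → q u ≡ q v → Path (λ f → In T f × Internal f) u v) → Fin n →
      suc (count (cutEdges T)) ℕ.≤ count (image q)
    1+cutEdges≤parts internally-connected x = begin
      suc (count (cutEdges T))                                   ≡⟨ ℕ.+-comm 1 (count (cutEdges T)) ⟩
      count (cutEdges T) ℕ.+ 1                                   ≤⟨ ℕ.+-monoʳ-≤ (count (cutEdges T)) (count-pos (image final) _ (image-intro final {x} refl)) ⟩
      count (cutEdges T) ℕ.+ count (image final)                 ≡⟨ cong (ℕ._+ count (image final)) (countAlong-allFin (cutEdges T)) ⟨
      countAlong (cutEdges T) (allFin m) ℕ.+ count (image final) ≤⟨ mergeAlong-count-exact (λ _ → ⊥) (allFin m) q initially (allFin⁺ m) (λ _ _ ()) ⟩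
      count (image q)                                            ∎
      where
      open ℕ.≤-Reasoning
      final = mergeAlong T (allFin m) q
      initially : ∀ u v → q u ≡ q v → Path (InternalOr λ _ → ⊥) u v
      initially u v h = path-mono (λ f (f∈ , i) → f∈ , inj₁ i) (internally-connected u v h)

-- Exchanging tree edges

exchange : ∀ {m} → (Fin m → Bool) → Fin m → Fin m → Fin m → Bool
exchange T e f g = (T g ∧ not (g == e)) ∨ (g == f)

module Exchange {n m : ℕ} (ends : Fin m → Fin n × Fin n) where
  open Graph ends

  exchange-new : ∀ T e f → In (exchange T e f) f
  exchange-new T e f = ∨-introʳ {T f ∧ not (f == e)} (==-refl f)

  exchange-old : ∀ T e f {g} → In T g → g ≢ e → In (exchange T e f) g
  exchange-old T e f g∈ g≢e = ∨-introˡ (∧-intro g∈ (not-intro (≢⇒== g≢e)))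

  exchange-elim : ∀ T e f {g} → In (exchange T e f) g → Without T e g ⊎ g ≡ f
  exchange-elim T e f {g} g∈ with ∨-elim {T g ∧ not (g == e)} g∈
  ... | inj₁ kept = let (g∈T , g≠e) = ∧-elim kept in inj₁ (g∈T , ==⇒≢ (not-elim g≠e))
  ... | inj₂ g==f = inj₂ (==⇒≡ g==f)

  reaches-an-end : ∀ T e → SpansGraph T → ∀ w → Path (Without T e) (src e) w ⊎ Path (Without T e) (tgt e) w
  reaches-an-end T e spans w with path-split e split (spans (src e) w)
    where
    split : ∀ g → In T g → Without T e g ⊎ g ≡ e
    split g g∈ with g ≟ e
    ... | yes g≡e = inj₂ g≡e
    ... | no g≢e  = inj₁ (g∈ , g≢e)
  ... | inj₁ p                = inj₁ p
  ... | inj₂ (inj₁ (_ , p))   = inj₂ p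
  ... | inj₂ (inj₂ (_ , p))   = inj₁ p

  module _ (T : Fin m → Bool) (e f : Fin m) (tree : IsSpanningTree ends T) (e∈T : In T e)
           (reconnects : ¬ Path (Without T e) (src f) (tgt f)) where

    private
      T′ = exchange T e f
      spans = proj₁ tree
      acyclic = proj₂ tree

      kept : ∀ {a b} → Path (Without T e) a b → Path (In T′) a b
      kept = path-mono λ g (g∈ , g≢e) → exchange-old T e f g∈ g≢e

      avoid-e : ∀ {g a b} → Path (λ h → In T h × h ≢ e × h ≢ g) a b → Path (Without T e) a b
      avoid-e = path-mono λ h (h∈ , h≢e , _) → h∈ , h≢e

    exchange-spans : SpansGraph T′
    exchange-spans u v = path-bind reroute (spans u v)
      where
      f-path : Path (In T′) (src f) (tgt f)
      f-path = path-edge f (exchange-new T e f)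
      e-path : Path (In T′) (src e) (tgt e)
      e-path with reaches-an-end T e spans (src f) | reaches-an-end T e spans (tgt f)
      ... | inj₁ p | inj₁ q = ⊥-elim (reconnects (path-trans (path-sym p) q))
      ... | inj₂ p | inj₂ q = ⊥-elim (reconnects (path-trans (path-sym p) q))
      ... | inj₁ p | inj₂ q = path-trans (kept p) (path-trans f-path (path-sym (kept q)))
      ... | inj₂ p | inj₁ q = path-trans (kept q) (path-trans (path-sym f-path) (path-sym (kept p)))
      reroute : ∀ g → In T g → Path (In T′) (src g) (tgt g)
      reroute g g∈ with g ≟ e
      ... | yes refl = e-path
      ... | no g≢e   = path-edge g (exchange-old T e f g∈ g≢e)

    exchange-acyclic : Acyclic T′
    exchange-acyclic g g∈ p with exchange-elim T e f g∈
    ... | inj₂ refl = reconnects (path-mono without-f p)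
      where
      without-f : ∀ h → Without T′ g h → Without T e h
      without-f h (h∈ , h≢f) with exchange-elim T e f h∈
      ... | inj₁ h∈T-e = h∈T-e
      ... | inj₂ h≡f   = ⊥-elim (h≢f h≡f)
    ... | inj₁ (g∈T , g≢e) with path-split f split p
      where
      split : ∀ h → Without T′ g h → (In T h × h ≢ e × h ≢ g) ⊎ h ≡ f
      split h (h∈ , h≢g) with exchange-elim T e f h∈
      ... | inj₁ (h∈T , h≢e) = inj₁ (h∈T , h≢e , h≢g)
      ... | inj₂ h≡f         = inj₂ h≡f
    ...   | inj₁ q                = acyclic g g∈T (path-mono (λ h (h∈ , _ , h≢g) → h∈ , h≢g) q)
    ...   | inj₂ (inj₁ (q₁ , q₂)) = reconnects (path-trans (path-sym (avoid-e q₁))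
                                      (path-trans (path-edge g (g∈T , g≢e)) (path-sym (avoid-e q₂))))
    ...   | inj₂ (inj₂ (q₁ , q₂)) = reconnects (path-trans (avoid-e q₂)
                                      (path-trans (path-edge˘ g (g∈T , g≢e)) (avoid-e q₁)))

    exchange-spanningTree : IsSpanningTree ends T′
    exchange-spanningTree = exchange-spans , exchange-acyclic

0≤1 : 0ℚ ≤ 1ℚ
0≤1 = nonNegative⁻¹ 1ℚ

0<1 : 0ℚ < 1ℚ
0<1 = positive⁻¹ 1ℚ

fromℕ : ℕ → ℚ
fromℕ zero    = 0ℚ
fromℕ (suc k) = 1ℚ + fromℕ k

fromℕ-+ : ∀ a b → fromℕ (a ℕ.+ b) ≡ fromℕ a + fromℕ b
fromℕ-+ zero    b = sym (+-identityˡ (fromℕ b))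
fromℕ-+ (suc a) b = trans (cong (λ x → 1ℚ + x) (fromℕ-+ a b)) (sym (+-assoc 1ℚ (fromℕ a) (fromℕ b)))

fromℕ-nonNeg : ∀ a → 0ℚ ≤ fromℕ a
fromℕ-nonNeg zero    = ≤-refl
fromℕ-nonNeg (suc a) = +-mono-≤ 0≤1 (fromℕ-nonNeg a)

fromℕ-pos : ∀ a → 0ℚ < fromℕ (suc a)
fromℕ-pos a = +-mono-<-≤ 0<1 (fromℕ-nonNeg a)

fromℕ-mono-≤ : ∀ {a b} → a ℕ.≤ b → fromℕ a ≤ fromℕ b
fromℕ-mono-≤ {a} a≤b with ℕ.m≤n⇒∃[o]m+o≡n a≤b
... | o , refl = subst₂ _≤_ (+-identityʳ (fromℕ a)) (sym (fromℕ-+ a o)) (+-monoʳ-≤ (fromℕ a) (fromℕ-nonNeg o))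

1/suc : ℕ → ℚ
1/suc i = ℤ.+ 1 / suc i

fromℕ*1/suc : ∀ i → fromℕ (suc i) * 1/suc i ≡ 1ℚ
fromℕ*1/suc i = toℚᵘ-injective (ℚᵘ.≃-trans (toℚᵘ-homo-* (fromℕ (suc i)) (1/suc i))
  (ℚᵘ.≃-trans (ℚᵘ.*-cong (fromℕ≃ (suc i)) (toℚᵘ-fromℚᵘ (ℚᵘ.mkℚᵘ (ℤ.+ 1) i)))
              (ℚᵘ.*≡* (trans (x*1*1≡1*x (ℤ.+ suc i)) (cong (λ k → ℤ.+ 1 ℤ.* ℤ.+ suc k) (sym (ℕ.+-identityʳ i)))))))
  where
  x*1*1≡1*x : ∀ x → (x ℤ.* ℤ.+ 1) ℤ.* ℤ.+ 1 ≡ ℤ.+ 1 ℤ.* x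
  x*1*1≡1*x x = trans (ℤ.*-identityʳ (x ℤ.* ℤ.+ 1)) (trans (ℤ.*-identityʳ x) (sym (ℤ.*-identityˡ x)))
  1+x*1≡1+x : ∀ x → (ℤ.+ 1 ℤ.+ x ℤ.* ℤ.+ 1) ℤ.* ℤ.+ 1 ≡ (ℤ.+ 1 ℤ.+ x) ℤ.* ℤ.+ 1
  1+x*1≡1+x x = cong (λ y → (ℤ.+ 1 ℤ.+ y) ℤ.* ℤ.+ 1) (ℤ.*-identityʳ x)
  fromℕ≃ : ∀ k → toℚᵘ (fromℕ k) ℚᵘ.≃ ℚᵘ.mkℚᵘ (ℤ.+ k) 0
  fromℕ≃ zero    = ℚᵘ.≃-refl
  fromℕ≃ (suc k) = ℚᵘ.≃-trans (toℚᵘ-homo-+ 1ℚ (fromℕ k))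
    (ℚᵘ.≃-trans (ℚᵘ.+-congʳ (toℚᵘ 1ℚ) (fromℕ≃ k)) (ℚᵘ.*≡* (1+x*1≡1+x (ℤ.+ k))))

1/suc-pos : ∀ i → 0ℚ < 1/suc i
1/suc-pos i = positive⁻¹ (1/suc i) {{normalize-pos 1 (suc i)}}

p≤q⇒0≤q-p : ∀ {p q} → p ≤ q → 0ℚ ≤ q - p
p≤q⇒0≤q-p {p} {q} p≤q = subst (_≤ q - p) (+-inverseʳ p) (+-monoˡ-≤ (- p) p≤q)

p<q⇒0<q-p : ∀ {p q} → p < q → 0ℚ < q - p
p<q⇒0<q-p {p} {q} p<q = subst (_< q - p) (+-inverseʳ p) (+-monoˡ-< (- p) p<q)

0<q-p⇒p<q : ∀ {p q} → 0ℚ < q - p → p < q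
0<q-p⇒p<q {p} {q} 0<q-p = subst₂ _<_ (+-identityʳ p) (p+[q-p]≡q p q) (+-monoʳ-< p 0<q-p)
  where
  p+[q-p]≡q : ∀ p q → p + (q - p) ≡ q
  p+[q-p]≡q = solve 2 (λ p q → p :+ (q :- p) := q) refl

q-p≡0⇒q≡p : ∀ {p q} → q - p ≡ 0ℚ → q ≡ p
q-p≡0⇒q≡p {p} {q} q-p≡0 = trans (q≡[q-p]+p p q) (trans (cong (_+ p) q-p≡0) (+-identityˡ p))
  where
  q≡[q-p]+p : ∀ p q → q ≡ (q - p) + p
  q≡[q-p]+p = solve 2 (λ p q → q := (q :- p) :+ p) refl

nonNeg≢0⇒pos : ∀ {p} → 0ℚ ≤ p → p ≢ 0ℚ → 0ℚ < p
nonNeg≢0⇒pos {p} 0≤p p≢0 with 0ℚ <? p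
... | yes 0<p = 0<p
... | no  0≮p = ⊥-elim (p≢0 (≤-antisym (≮⇒≥ 0≮p) 0≤p))

*-cancelˡ-≡-pos : ∀ {t p q} → 0ℚ < t → t * p ≡ t * q → p ≡ q
*-cancelˡ-≡-pos {t} 0<t tp≡tq = ≤-antisym
  (*-cancelˡ-≤-pos t {{positive 0<t}} (≤-reflexive tp≡tq)) (*-cancelˡ-≤-pos t {{positive 0<t}} (≤-reflexive (sym tp≡tq)))

*-nonNeg : ∀ {p q} → 0ℚ ≤ p → 0ℚ ≤ q → 0ℚ ≤ p * q
*-nonNeg {p} {q} 0≤p 0≤q = nonNegative⁻¹ (p * q) {{nonNeg*nonNeg⇒nonNeg p {{nonNegative 0≤p}} q {{nonNegative 0≤q}}}}

*-pos : ∀ {p q} → 0ℚ < p → 0ℚ < q → 0ℚ < p * q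
*-pos {p} {q} 0<p 0<q = positive⁻¹ (p * q) {{pos*pos⇒pos p {{positive 0<p}} q {{positive 0<q}}}}

mix : ℚ → ℚ → ℚ → ℚ
mix t x y = t * x + (1ℚ - t) * y

mix-0-0 : ∀ t → mix t 0ℚ 0ℚ ≡ 0ℚ
mix-0-0 = solve 1 (λ t → t :* con 0ℚ :+ (con 1ℚ :- t) :* con 0ℚ := con 0ℚ) refl

mix-x-0 : ∀ t x → mix t x 0ℚ ≡ t * x
mix-x-0 = solve 2 (λ t x → t :* x :+ (con 1ℚ :- t) :* con 0ℚ := t :* x) refl

mix-0-y : ∀ t y → mix t 0ℚ y ≡ (1ℚ - t) * y
mix-0-y = solve 2 (λ t y → t :* con 0ℚ :+ (con 1ℚ :- t) :* y := (con 1ℚ :- t) :* y) refl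

module _ {t : ℚ} (0<t : 0ℚ < t) (t<1 : t < 1ℚ) where

  mix≡0⇒≡0 : ∀ {x y} → 0ℚ ≤ x → 0ℚ ≤ y → mix t x y ≡ 0ℚ → x ≡ 0ℚ
  mix≡0⇒≡0 {x} {y} 0≤x 0≤y mix≡0 = *-cancelˡ-≡-pos 0<t (trans tx≡0 (sym (*-zeroʳ t)))
    where
    0≤tx = *-nonNeg (<⇒≤ 0<t) 0≤x
    0≤sy = *-nonNeg (<⇒≤ (p<q⇒0<q-p t<1)) 0≤y
    tx≡0 : t * x ≡ 0ℚ
    tx≡0 = ≤-antisym (subst (t * x ≤_) mix≡0 (subst (_≤ mix t x y) (+-identityʳ (t * x)) (+-monoʳ-≤ (t * x) 0≤sy))) 0≤tx

  mix≡1⇒≡1 : ∀ {x y} → 1ℚ ≤ x → 1ℚ ≤ y → mix t x y ≡ 1ℚ → x ≡ 1ℚ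
  mix≡1⇒≡1 {x} {y} 1≤x 1≤y mix≡1 =
    q-p≡0⇒q≡p (mix≡0⇒≡0 (p≤q⇒0≤q-p 1≤x) (p≤q⇒0≤q-p 1≤y)
      (trans (mix-shift t x y) (trans (cong (_- 1ℚ) mix≡1) (+-inverseʳ 1ℚ))))
    where
    mix-shift : ∀ t x y → mix t (x - 1ℚ) (y - 1ℚ) ≡ mix t x y - 1ℚ
    mix-shift = solve 3 (λ t x y → t :* (x :- con 1ℚ) :+ (con 1ℚ :- t) :* (y :- con 1ℚ)
                                := (t :* x :+ (con 1ℚ :- t) :* y) :- con 1ℚ) refl

mix-fixed : ∀ {t r b} → t < 1ℚ → r ≡ mix t r b → b ≡ r
mix-fixed {t} {r} {b} t<1 r≡mix = *-cancelˡ-≡-pos (p<q⇒0<q-p t<1) (begin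
  (1ℚ - t) * b      ≡⟨ isolate t r b ⟨
  mix t r b - t * r ≡⟨ cong (_- t * r) r≡mix ⟨
  r - t * r         ≡⟨ factor t r ⟩
  (1ℚ - t) * r      ∎)
  where
  open ≡-Reasoning
  isolate : ∀ t r b → mix t r b - t * r ≡ (1ℚ - t) * b
  isolate = solve 3 (λ t r b → (t :* r :+ (con 1ℚ :- t) :* b) :- t :* r := (con 1ℚ :- t) :* b) refl
  factor : ∀ t r → r - t * r ≡ (1ℚ - t) * r
  factor = solve 2 (λ t r → r :- t :* r := (con 1ℚ :- t) :* r) refl

positiveLowerBound : ∀ {m} {P : Fin m → Set} → Decidable P → (f : Fin m → ℚ) → (∀ e → P e → 0ℚ < f e) →
  ∃ λ μ → 0ℚ < μ × (∀ e → P e → μ ≤ f e)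
positiveLowerBound {zero} P? f pos = 1ℚ , 0<1 , λ ()
positiveLowerBound {suc m} {P} P? f pos with positiveLowerBound (P? ∘ suc) (f ∘ suc) (pos ∘ suc) | P? zero
... | μ , 0<μ , μ≤ | no ¬P0 = μ , 0<μ , λ { zero P0 → ⊥-elim (¬P0 P0) ; (suc e) → μ≤ e }
... | μ , 0<μ , μ≤ | yes P0 = f zero ⊓ μ , 0<min , min≤
  where
  min≤ : ∀ e → P e → f zero ⊓ μ ≤ f e
  min≤ zero    _  = p⊓q≤p (f zero) μ
  min≤ (suc e) Pe = ≤-trans (p⊓q≤q (f zero) μ) (μ≤ e Pe)
  0<min : 0ℚ < f zero ⊓ μ
  0<min with ⊓-sel (f zero) μ
  ... | inj₁ min≡f0 = subst (0ℚ <_) (sym min≡f0) (pos zero P0)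
  ... | inj₂ min≡μ  = subst (0ℚ <_) (sym min≡μ) 0<μ

1≤x+y⇒1-z≤x : ∀ {x y z} → 1ℚ ≤ x + y → y ≤ z → 1ℚ - z ≤ x
1≤x+y⇒1-z≤x {x} {y} {z} 1≤x+y y≤z = subst (1ℚ - z ≤_) (solve 2 (λ x y → (x :+ y) :- y := x) refl x y)
  (+-mono-≤ 1≤x+y (neg-antimono-≤ y≤z))

Σℚ-cong : ∀ {m} (f g : Fin m → ℚ) → (∀ i → f i ≡ g i) → Σℚ f ≡ Σℚ g
Σℚ-cong {zero}  f g f≗g = refl
Σℚ-cong {suc m} f g f≗g = cong₂ _+_ (f≗g zero) (Σℚ-cong (f ∘ suc) (g ∘ suc) (f≗g ∘ suc))

Σℚ-+ : ∀ {m} (f g : Fin m → ℚ) → Σℚ (λ i → f i + g i) ≡ Σℚ f + Σℚ g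
Σℚ-+ {zero}  f g = sym (+-identityˡ 0ℚ)
Σℚ-+ {suc m} f g = trans (cong ((f zero + g zero) +_) (Σℚ-+ (f ∘ suc) (g ∘ suc)))
                         (interchange (f zero) (g zero) (Σℚ (f ∘ suc)) (Σℚ (g ∘ suc)))
  where
  interchange : ∀ a b c d → (a + b) + (c + d) ≡ (a + c) + (b + d)
  interchange = solve 4 (λ a b c d → (a :+ b) :+ (c :+ d) := (a :+ c) :+ (b :+ d)) refl

Σℚ-*ˡ : ∀ {m} c (f : Fin m → ℚ) → Σℚ (λ i → c * f i) ≡ c * Σℚ f
Σℚ-*ˡ {zero}  c f = sym (*-zeroʳ c)
Σℚ-*ˡ {suc m} c f = trans (cong (c * f zero +_) (Σℚ-*ˡ c (f ∘ suc))) (sym (*-distribˡ-+ c (f zero) (Σℚ (f ∘ suc))))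

Σℚ-mono-≤ : ∀ {m} (f g : Fin m → ℚ) → (∀ i → f i ≤ g i) → Σℚ f ≤ Σℚ g
Σℚ-mono-≤ {zero}  f g f≤g = ≤-refl
Σℚ-mono-≤ {suc m} f g f≤g = +-mono-≤ (f≤g zero) (Σℚ-mono-≤ (f ∘ suc) (g ∘ suc) (f≤g ∘ suc))

Σℚ-indicator : ∀ {m} (b : Fin m → Bool) c → Σℚ (λ i → if b i then c else 0ℚ) ≡ fromℕ (count b) * c
Σℚ-indicator {zero}  b c = sym (*-zeroˡ c)
Σℚ-indicator {suc m} b c with b zero
... | true  = trans (cong (c +_) (Σℚ-indicator (b ∘ suc) c)) (c+kc≡[1+k]c c (fromℕ (count (b ∘ suc))))
  where
  c+kc≡[1+k]c : ∀ c k → c + k * c ≡ (1ℚ + k) * c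
  c+kc≡[1+k]c = solve 2 (λ c k → c :+ k :* c := (con 1ℚ :+ k) :* c) refl
... | false = trans (+-identityˡ _) (Σℚ-indicator (b ∘ suc) c)

Σℚ-single : ∀ {m} (e : Fin m) x → Σℚ (λ i → if i == e then x else 0ℚ) ≡ x
Σℚ-single e x = begin
  Σℚ (λ i → if i == e then x else 0ℚ) ≡⟨ Σℚ-indicator (_== e) x ⟩
  fromℕ (count (_== e)) * x           ≡⟨ cong (λ k → fromℕ k * x) (count-single e) ⟩
  (1ℚ + 0ℚ) * x                       ≡⟨ solve 1 (λ x → (con 1ℚ :+ con 0ℚ) :* x := x) refl x ⟩
  x                                   ∎
  where open ≡-Reasoning

weight : ∀ {m} → (Fin m → Bool) → (Fin m → ℚ) → ℚ
weight T a = Σℚ λ e → 𝟙 T e * a e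

weight-cong : ∀ {m} (T : Fin m → Bool) {a b : Fin m → ℚ} → (∀ e → a e ≡ b e) → weight T a ≡ weight T b
weight-cong T a≗b = Σℚ-cong _ _ λ e → cong (𝟙 T e *_) (a≗b e)

weight-+ : ∀ {m} (T : Fin m → Bool) (a b : Fin m → ℚ) → weight T (λ e → a e + b e) ≡ weight T a + weight T b
weight-+ T a b =
  trans (Σℚ-cong _ _ λ e → *-distribˡ-+ (𝟙 T e) (a e) (b e)) (Σℚ-+ (λ e → 𝟙 T e * a e) (λ e → 𝟙 T e * b e))

weight-*ˡ : ∀ {m} (T : Fin m → Bool) c (a : Fin m → ℚ) → weight T (λ e → c * a e) ≡ c * weight T a
weight-*ˡ T c a = trans (Σℚ-cong _ _ λ e → solve 3 (λ i c x → i :* (c :* x) := c :* (i :* x)) refl (𝟙 T e) c (a e))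
                        (Σℚ-*ˡ c (λ e → 𝟙 T e * a e))

weight-mix : ∀ {m} (T : Fin m → Bool) {ρ a b : Fin m → ℚ} t → (∀ e → ρ e ≡ mix t (a e) (b e)) →
  weight T ρ ≡ mix t (weight T a) (weight T b)
weight-mix T {ρ} {a} {b} t ρ≡mix = begin
  weight T ρ                                                 ≡⟨ weight-cong T ρ≡mix ⟩
  weight T (λ e → t * a e + (1ℚ - t) * b e)                  ≡⟨ weight-+ T (λ e → t * a e) (λ e → (1ℚ - t) * b e) ⟩
  weight T (λ e → t * a e) + weight T (λ e → (1ℚ - t) * b e) ≡⟨ cong₂ _+_ (weight-*ˡ T t a) (weight-*ˡ T (1ℚ - t) b) ⟩
  mix t (weight T a) (weight T b)                            ∎
  where open ≡-Reasoning

weight-mono-≤ : ∀ {m} (T : Fin m → Bool) {a b : Fin m → ℚ} → (∀ e → a e ≤ b e) → weight T a ≤ weight T b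
weight-mono-≤ T {a} {b} a≤b = Σℚ-mono-≤ _ _ pointwise
  where
  pointwise : ∀ e → 𝟙 T e * a e ≤ 𝟙 T e * b e
  pointwise e with T e
  ... | true  = subst₂ _≤_ (sym (*-identityˡ (a e))) (sym (*-identityˡ (b e))) (a≤b e)
  ... | false = subst₂ _≤_ (sym (*-zeroˡ (a e))) (sym (*-zeroˡ (b e))) ≤-refl

weight-uniform : ∀ {m} (T h : Fin m → Bool) {a : Fin m → ℚ} α → (∀ e → T e ≡ true → a e ≡ (if h e then α else 0ℚ)) →
  weight T a ≡ fromℕ (count λ e → T e ∧ h e) * α
weight-uniform T h {a} α a-on-T = trans (Σℚ-cong _ _ pointwise) (Σℚ-indicator (λ e → T e ∧ h e) α)
  where
  pointwise : ∀ e → 𝟙 T e * a e ≡ (if T e ∧ h e then α else 0ℚ)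
  pointwise e with T e in e∈T
  ... | true  = trans (*-identityˡ (a e)) (a-on-T e e∈T)
  ... | false = *-zeroˡ (a e)

weight-exchange : ∀ {m} (T : Fin m → Bool) e f (a : Fin m → ℚ) → T e ≡ true → T f ≡ false → f ≢ e →
  weight (exchange T e f) a + a e ≡ weight T a + a f
weight-exchange T e f a e∈T f∉T f≢e = begin
  weight (exchange T e f) a + a e                                      ≡⟨ cong (weight (exchange T e f) a +_) (Σℚ-single e (a e)) ⟨
  weight (exchange T e f) a + Σℚ (λ g → if g == e then a e else 0ℚ)    ≡⟨ Σℚ-+ (λ g → 𝟙 (exchange T e f) g * a g) (λ g → if g == e then a e else 0ℚ) ⟨
  Σℚ (λ g → 𝟙 (exchange T e f) g * a g + (if g == e then a e else 0ℚ)) ≡⟨ Σℚ-cong _ _ pointwise ⟩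
  Σℚ (λ g → 𝟙 T g * a g + (if g == f then a f else 0ℚ))                ≡⟨ Σℚ-+ (λ g → 𝟙 T g * a g) (λ g → if g == f then a f else 0ℚ) ⟩
  weight T a + Σℚ (λ g → if g == f then a f else 0ℚ)                   ≡⟨ cong (weight T a +_) (Σℚ-single f (a f)) ⟩
  weight T a + a f                                                     ∎
  where
  open ≡-Reasoning
  0x+x≡1x+0 : ∀ x → 0ℚ * x + x ≡ 1ℚ * x + 0ℚ
  0x+x≡1x+0 = solve 1 (λ x → con 0ℚ :* x :+ x := con 1ℚ :* x :+ con 0ℚ) refl
  pointwise : ∀ g → 𝟙 (exchange T e f) g * a g + (if g == e then a e else 0ℚ) ≡ 𝟙 T g * a g + (if g == f then a f else 0ℚ)
  pointwise g with g == e in g=e | g == f in g=f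
  ... | true  | true  = ⊥-elim (f≢e (trans (sym (==⇒≡ {i = g} g=f)) (==⇒≡ {i = g} g=e)))
  ... | true  | false with T g in g∈T
  ...   | true  = subst (λ x → 0ℚ * a g + x ≡ 1ℚ * a g + 0ℚ) (cong a (==⇒≡ {i = g} g=e)) (0x+x≡1x+0 (a g))
  ...   | false = ⊥-elim (true≢false (trans (sym e∈T) (trans (cong T (sym (==⇒≡ {i = g} g=e))) g∈T)))
  pointwise g | false | true with T g in g∈T
  ...   | true  = ⊥-elim (true≢false (trans (sym g∈T) (trans (cong T (==⇒≡ {i = g} g=f)) f∉T)))
  ...   | false = subst (λ x → 1ℚ * a g + 0ℚ ≡ 0ℚ * a g + x) (cong a (==⇒≡ {i = g} g=f)) (sym (0x+x≡1x+0 (a g)))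
  pointwise g | false | false with T g
  ...   | true  = refl
  ...   | false = refl

Adm-cong : ∀ {n m} (ends : Fin m → Fin n × Fin n) {a b : Fin m → ℚ} → (∀ e → a e ≡ b e) → Adm ends a → Adm ends b
Adm-cong ends a≗b (nonNeg , covers) =
  (λ e → subst (0ℚ ≤_) (a≗b e) (nonNeg e)) ,
  (λ T tree → subst (1ℚ ≤_) (weight-cong T a≗b) (covers T tree))

weight-mono-⊆ : ∀ {m} (S T : Fin m → Bool) (a : Fin m → ℚ) → (∀ e → 0ℚ ≤ a e) →
  (∀ e → S e ≡ true → T e ≡ true ⊎ a e ≡ 0ℚ) → weight S a ≤ weight T a
weight-mono-⊆ S T a a≥0 S⊆T = Σℚ-mono-≤ _ _ pointwise
  where
  𝟙-nonNeg : ∀ b → 0ℚ ≤ (if b then 1ℚ else 0ℚ)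
  𝟙-nonNeg true  = 0≤1
  𝟙-nonNeg false = ≤-refl
  pointwise : ∀ e → 𝟙 S e * a e ≤ 𝟙 T e * a e
  pointwise e with S e in e∈S
  ... | false = subst (_≤ 𝟙 T e * a e) (sym (*-zeroˡ (a e))) (*-nonNeg (𝟙-nonNeg (T e)) (a≥0 e))
  ... | true with T e | S⊆T e e∈S
  ...   | true  | _         = ≤-refl
  ...   | false | inj₂ ae≡0 = ≤-reflexive (trans (*-identityˡ (a e)) (trans ae≡0 (sym (*-zeroˡ (a e)))))

-- Cut weights and tight trees

module Partition {n m K : ℕ} (ends : Fin m → Fin n × Fin n) (p : Fin n → Fin K) where
  open Graph ends
  open CutCount ends p

  -- cutWeight i is definitionally cutVector i ends p.
  cutWeight : ℕ → Fin m → ℚ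
  cutWeight i e = if p (src e) == p (tgt e) then 0ℚ else 1/suc i

  cutWeight-indicator : ∀ i e → cutWeight i e ≡ (if isCut e then 1/suc i else 0ℚ)
  cutWeight-indicator i e with p (src e) == p (tgt e)
  ... | true  = refl
  ... | false = refl

  cutWeight-internal : ∀ i {e} → Internal e → cutWeight i e ≡ 0ℚ
  cutWeight-internal i internal rewrite ≡⇒== internal = refl

  cutWeight-cut : ∀ i {e} → ¬ Internal e → cutWeight i e ≡ 1/suc i
  cutWeight-cut i cut rewrite ≢⇒== cut = refl

  weight-cutWeight : ∀ T i → weight T (cutWeight i) ≡ fromℕ (count (cutEdges T)) * 1/suc i
  weight-cutWeight T i = weight-uniform T isCut (1/suc i) λ e _ → cutWeight-indicator i e

  cutWeight-nonNeg : ∀ i e → 0ℚ ≤ cutWeight i e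
  cutWeight-nonNeg i e with p (src e) == p (tgt e)
  ... | true  = ≤-refl
  ... | false = <⇒≤ (1/suc-pos i)

  weight-cutWeight-≥ : ∀ T j {i} → i ℕ.≤ count (cutEdges T) → fromℕ i * 1/suc j ≤ weight T (cutWeight j)
  weight-cutWeight-≥ T j {i} i≤cut = subst (fromℕ i * 1/suc j ≤_) (sym (weight-cutWeight T j))
    (*-monoʳ-≤-nonNeg (1/suc j) {{nonNegative (<⇒≤ (1/suc-pos j))}} (fromℕ-mono-≤ i≤cut))

  cutWeight-admissible : ∀ i → count (image p) ≡ suc (suc i) → Adm ends (cutWeight i)
  cutWeight-admissible i parts≡ = cutWeight-nonNeg i , λ T (spans , _) →
    subst (_≤ weight T (cutWeight i)) (fromℕ*1/suc i)
      (weight-cutWeight-≥ T i (ℕ.≤-pred (subst (ℕ._≤ suc (count (cutEdges T))) parts≡ (parts≤1+cutEdges T spans))))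

  SpansParts : (Fin m → Bool) → Set
  SpansParts T = ∀ u v → p u ≡ p v → Path (λ f → In T f × Internal f) u v

module Tight {n m j : ℕ} (ends : Fin m → Fin n × Fin n) (p : Fin n → Fin (suc (suc j)))
             (surjective : Surjective _≡_ _≡_ p) where
  open Graph ends
  open Kruskal ends
  open CutCount ends p
  open Partition ends p

  parts≡ : count (image p) ≡ suc (suc j)
  parts≡ = count-image-surjective p surjective

  tree-cutEdges-≥ : ∀ T → IsSpanningTree ends T → suc j ℕ.≤ count (cutEdges T)
  tree-cutEdges-≥ T (spans , _) = ℕ.≤-pred (subst (ℕ._≤ suc (count (cutEdges T))) parts≡ (parts≤1+cutEdges T spans))

  tree-cutEdges-≤ : ∀ T → IsSpanningTree ends T → SpansParts T → count (cutEdges T) ℕ.≤ suc j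
  tree-cutEdges-≤ T (_ , acyclic) spansParts =
    ℕ.≤-pred (subst (suc (count (cutEdges T)) ℕ.≤_) parts≡ (1+cutEdges≤parts T acyclic spansParts (proj₁ (surjective zero))))

  tight-cutEdges : ∀ T → IsSpanningTree ends T → SpansParts T → count (cutEdges T) ≡ suc j
  tight-cutEdges T tree spansParts = ℕ.≤-antisym (tree-cutEdges-≤ T tree spansParts) (tree-cutEdges-≥ T tree)

  tight : ∀ T → IsSpanningTree ends T → SpansParts T → weight T (cutWeight j) ≡ 1ℚ
  tight T tree spansParts = begin
    weight T (cutWeight j)               ≡⟨ weight-cutWeight T j ⟩
    fromℕ (count (cutEdges T)) * 1/suc j ≡⟨ cong (λ k → fromℕ k * 1/suc j) (tight-cutEdges T tree spansParts) ⟩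
    fromℕ (suc j) * 1/suc j              ≡⟨ fromℕ*1/suc j ⟩
    1ℚ                                   ∎
    where open ≡-Reasoning

  cut-edge : Connected ends → ∃ λ e → ¬ Internal e
  cut-edge connected with path-crossing (λ w → p w ≡ p u₀) (λ w → p w ≟ p u₀) (connected u₀ u₁) refl u₁∉
    where
    u₀ = proj₁ (surjective zero)
    u₁ = proj₁ (surjective (suc zero))
    u₁∉ : p u₁ ≢ p u₀
    u₁∉ same with () ← trans (sym (proj₂ (surjective (suc zero)) refl)) (trans same (proj₂ (surjective zero) refl))
  ... | e , _ , inj₁ (s∈ , t∉) = e , λ internal → t∉ (trans (sym internal) s∈)
  ... | e , _ , inj₂ (s∉ , t∈) = e , λ internal → s∉ (trans internal t∈)

  module Trees (connected : Connected ends) (internally-connected : ∀ u v → p u ≡ p v → Path Internal u v) where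

    complete : LabelledForest → Fin m → Bool
    complete φ = edges (grow (λ _ → yes tt) φ)

    internalForest : LabelledForest
    internalForest = grow (λ e → p (src e) ≟ p (tgt e)) emptyForest

    internalForest-internal : ∀ e → In (edges internalForest) e → Internal e
    internalForest-internal e e∈ with grow-⊆ (λ e → p (src e) ≟ p (tgt e)) emptyForest e∈
    ... | inj₂ internal = internal

    internalForest-connects : ∀ u v → p u ≡ p v → Path (In (edges internalForest)) u v
    internalForest-connects u v same = grow-connects _ emptyForest (internally-connected u v same)

    spansParts-⊇ : ∀ T → (∀ e → In (edges internalForest) e → In T e) → SpansParts T
    spansParts-⊇ T ⊇internal u v same =
      path-mono (λ e e∈ → ⊇internal e e∈ , internalForest-internal e e∈) (internalForest-connects u v same)

    tightTree : Fin m → Bool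
    tightTree = complete internalForest

    tightTree-spanningTree : IsSpanningTree ends tightTree
    tightTree-spanningTree = grow-spanningTree connected internalForest

    tightTree-spansParts : SpansParts tightTree
    tightTree-spansParts = spansParts-⊇ tightTree λ e → grow-⊇ _ internalForest

    record Exchangeable (e f : Fin m) : Set where
      field
        tree         : Fin m → Bool
        spanningTree : IsSpanningTree ends tree
        spansParts   : SpansParts tree
        e∈tree       : In tree e
        reconnects   : ¬ Path (Without tree e) (src f) (tgt f)

    Avoids : Fin (suc (suc j)) → Fin m → Set
    Avoids B g = Internal g ⊎ (p (src g) ≢ B × p (tgt g) ≢ B)

    avoids? : ∀ B g → Dec (Avoids B g)
    avoids? B g = (p (src g) ≟ p (tgt g)) ⊎-dec (¬? (p (src g) ≟ B) ×-dec ¬? (p (tgt g) ≟ B))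

    avoiding-path-stays : ∀ {B x y} → Path (Avoids B) x y → p x ≡ B → p y ≡ B
    avoiding-path-stays {B} = path-preserves (λ w → p w ≡ B) forward backward
      where
      forward : ∀ g → Avoids B g → p (src g) ≡ B → p (tgt g) ≡ B
      forward g (inj₁ internal)   s∈ = trans (sym internal) s∈
      forward g (inj₂ (s∉ , _))  s∈ = ⊥-elim (s∉ s∈)
      backward : ∀ g → Avoids B g → p (tgt g) ≡ B → p (src g) ≡ B
      backward g (inj₁ internal)  t∈ = trans internal t∈
      backward g (inj₂ (_ , t∉)) t∈ = ⊥-elim (t∉ t∈)

    -- Grow the tree from a forest spanning the parts, then the edges avoiding B,
    -- then e.  A path around e through f would close a cycle through e via B.
    exchangeable : ∀ {e f B eb ea fb fc} → Joins e eb ea → Joins f fb fc → p eb ≡ B → p fb ≡ B → p ea ≢ B →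
      Path (Avoids B) ea fc → Exchangeable e f
    exchangeable {e} {f} {B} {eb} {ea} {fb} {fc} e-joins f-joins eb∈B fb∈B ea∉B ea⇝fc = record
      { tree = T ; spanningTree = grow-spanningTree connected φ₃ ; spansParts = spansParts-⊇ T φ₁⊆T
      ; e∈tree = e∈T ; reconnects = reconnects }
      where
      φ₁ = internalForest
      φ₂ = grow (avoids? B) φ₁
      φ₃ = grow (_≟ e) φ₂
      T  = complete φ₃
      φ₂⊆T : ∀ g → In (edges φ₂) g → In T g
      φ₂⊆T g = grow-⊇ _ φ₃ ∘ grow-⊇ _ φ₂
      φ₁⊆T : ∀ g → In (edges φ₁) g → In T g
      φ₁⊆T g = φ₂⊆T g ∘ grow-⊇ _ φ₁
      φ₂-avoids : ∀ g → In (edges φ₂) g → Avoids B g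
      φ₂-avoids g g∈ with grow-⊆ (avoids? B) φ₁ g∈
      ... | inj₁ g∈φ₁   = inj₁ (internalForest-internal g g∈φ₁)
      ... | inj₂ avoids = avoids
      e-leaves : ¬ Path (Avoids B) (src e) (tgt e)
      e-leaves path = ea∉B (avoiding-path-stays (joins-from e-joins path) eb∈B)
      e-avoids-not : ¬ Avoids B e
      e-avoids-not = e-leaves ∘ path-edge e
      e∈T : In T e
      e∈T = grow-⊇ _ φ₃ (grow-forces φ₂ e (e-leaves ∘ path-mono φ₂-avoids))
      reconnects : ¬ Path (Without T e) (src f) (tgt f)
      reconnects f-path = proj₂ (grow-spanningTree connected φ₃) e e∈T (joins-to e-joins
        (path-trans (in-φ₁ (internalForest-connects eb fb (trans eb∈B (sym fb∈B))))
        (path-trans (joins-from f-joins f-path)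
                    (path-sym (in-φ₂ (grow-connects (avoids? B) φ₁ ea⇝fc))))))
        where
        in-φ₁ : ∀ {a b} → Path (In (edges φ₁)) a b → Path (Without T e) a b
        in-φ₁ = path-mono λ g g∈ → φ₁⊆T g g∈ , λ { refl → e-avoids-not (inj₁ (internalForest-internal g g∈)) }
        in-φ₂ : ∀ {a b} → Path (In (edges φ₂)) a b → Path (Without T e) a b
        in-φ₂ = path-mono λ g g∈ → φ₂⊆T g g∈ , λ { refl → e-avoids-not (φ₂-avoids g g∈) }

-- Cut weights of biconnected feasible partitions are extreme

IsBlocker-cong : ∀ {n m} (ends : Fin m → Fin n × Fin n) {ρ σ : Fin m → ℚ} → (∀ e → ρ e ≡ σ e) →
  IsBlocker ends ρ → IsBlocker ends σ
IsBlocker-cong ends ρ≗σ (adm , extreme) = Adm-cong ends ρ≗σ adm , λ a b t adm-a adm-b 0<t t<1 σ≡mix →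
  let (a≗ρ , b≗ρ) = extreme a b t adm-a adm-b 0<t t<1 (λ e → trans (ρ≗σ e) (σ≡mix e)) in
  (λ e → trans (a≗ρ e) (ρ≗σ e)) , (λ e → trans (b≗ρ e) (ρ≗σ e))

module Extreme {n m j : ℕ} (ends : Fin m → Fin n × Fin n) (connected : Connected ends)
               (p : Fin n → Fin (suc (suc j))) (feasible : FeasiblePartition ends p)
               (biconnected : ShrunkBiconnected ends p) where
  open Graph ends
  open CutCount ends p
  open Partition ends p
  open Tight ends p (proj₁ feasible)

  internally-connected : ∀ u v → p u ≡ p v → Path Internal u v
  internally-connected u v same = path-mono (λ e (_ , s∈ , t∈) → trans s∈ (sym t∈))
    (reach⇒path (proj₂ feasible (p u) u v refl (sym same)))

  open Trees connected internally-connected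

  lift : ∀ {B X Y} → Reach (shrunkEnds ends p) (_≢ B) (IsCut ends p) X Y → ∀ x y → p x ≡ X → p y ≡ Y → Path (Avoids B) x y
  lift here x y x∈ y∈ = path-mono (λ _ → inj₁) (internally-connected x y (trans x∈ (sym y∈)))
  lift (stepˡ g _ s∉ t∉ rest) x y x∈ y∈ = path-trans (path-mono (λ _ → inj₁) (internally-connected x (src g) x∈))
    (path-trans (path-edge g (inj₂ (s∉ , t∉))) (lift rest (tgt g) y refl y∈))
  lift (stepʳ g _ s∉ t∉ rest) x y x∈ y∈ = path-trans (path-mono (λ _ → inj₁) (internally-connected x (tgt g) x∈))
    (path-trans (path-edge˘ g (inj₂ (s∉ , t∉))) (lift rest (src g) y refl y∈))

  avoiding-path : ∀ B x y → p x ≢ B → p y ≢ B → Path (Avoids B) x y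
  avoiding-path B x y x∉ y∉ = lift (proj₂ biconnected B (p x) (p y) x∉ y∉) x y refl refl

  Touches : Fin (suc (suc j)) → Fin m → Set
  Touches X g = p (src g) ≡ X ⊎ p (tgt g) ≡ X

  leaves : ∀ {X g} → ¬ Internal g → Touches X g → ∃₂ λ x y → Joins g x y × p x ≡ X × p y ≢ X
  leaves cut (inj₁ s∈) = _ , _ , inj₁ (refl , refl) , s∈ , λ t∈ → cut (trans s∈ (sym t∈))
  leaves cut (inj₂ t∈) = _ , _ , inj₂ (refl , refl) , t∈ , λ s∈ → cut (trans s∈ (sym t∈))

  joins-cut : ∀ {e x y} → Joins e x y → p x ≢ p y → ¬ Internal e
  joins-cut (inj₁ (refl , refl)) x≁y = x≁y
  joins-cut (inj₂ (refl , refl)) x≁y = x≁y ∘ sym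

  module _ (a b : Fin m → ℚ) (τ : ℚ) (adm-a : Adm ends a) (adm-b : Adm ends b)
           (0<τ : 0ℚ < τ) (τ<1 : τ < 1ℚ) (cutWeight≡mix : ∀ e → cutWeight j e ≡ mix τ (a e) (b e)) where

    a-internal : ∀ e → Internal e → a e ≡ 0ℚ
    a-internal e internal = mix≡0⇒≡0 0<τ τ<1 (proj₁ adm-a e) (proj₁ adm-b e)
      (trans (sym (cutWeight≡mix e)) (cutWeight-internal j internal))

    a-tight : ∀ T → IsSpanningTree ends T → SpansParts T → weight T a ≡ 1ℚ
    a-tight T tree spansParts = mix≡1⇒≡1 0<τ τ<1 (proj₂ adm-a T tree) (proj₂ adm-b T tree)
      (trans (sym (weight-mix T τ cutWeight≡mix)) (tight T tree spansParts))

    a-adjacent : ∀ {e f B eb ea fb fc} → Joins e eb ea → Joins f fb fc → p eb ≡ B → p fb ≡ B → p ea ≢ B → p fc ≢ B →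
      a e ≡ a f
    a-adjacent {e} {f} {B} {eb} {ea} {fb} {fc} e-joins f-joins eb∈B fb∈B ea∉B fc∉B with f ≟ e
    ... | yes refl = refl
    -- a has weight 1 on the tight trees T and T - e + f.
    ... | no f≢e = +-cancelˡ 1ℚ (a e) (a f) (begin
      1ℚ + a e          ≡⟨ cong (_+ a e) (a-tight T′ T′-spanningTree T′-spansParts) ⟨
      weight T′ a + a e ≡⟨ weight-exchange T e f a e∈tree f∉T f≢e ⟩
      weight T a + a f  ≡⟨ cong (_+ a f) (a-tight T spanningTree spansParts) ⟩
      1ℚ + a f          ∎)
      where
      open ≡-Reasoning
      open Exchangeable (exchangeable e-joins f-joins eb∈B fb∈B ea∉B (avoiding-path B ea fc ea∉B fc∉B)) renaming (tree to T)
      T′ = exchange T e f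
      T′-spanningTree : IsSpanningTree ends T′
      T′-spanningTree = Exchange.exchange-spanningTree ends T e f spanningTree e∈tree reconnects
      e-cut : ¬ Internal e
      e-cut = joins-cut e-joins λ same → ea∉B (trans (sym same) eb∈B)
      T′-spansParts : SpansParts T′
      T′-spansParts u v same = path-mono (λ g (g∈ , internal) →
        Exchange.exchange-old ends T e f g∈ (λ { refl → e-cut internal }) , internal) (spansParts u v same)
      f∉T : T f ≡ false
      f∉T with T f in f∈?
      ... | true  = ⊥-elim (reconnects (path-edge f (f∈? , f≢e)))
      ... | false = refl

    a-touching : ∀ {X g h} → ¬ Internal g → ¬ Internal h → Touches X g → Touches X h → a g ≡ a h
    a-touching g-cut h-cut g-touches h-touches with leaves g-cut g-touches | leaves h-cut h-touches
    ... | _ , _ , g-joins , gx∈ , gy∉ | _ , _ , h-joins , hx∈ , hy∉ = a-adjacent g-joins h-joins gx∈ hx∈ gy∉ hy∉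

    e₀ : Fin m
    e₀ = proj₁ (cut-edge connected)

    α : ℚ
    α = a e₀

    TouchedWithValue : Fin (suc (suc j)) → Set
    TouchedWithValue X = ∃ λ g → ¬ Internal g × Touches X g × a g ≡ α

    propagate : ∀ {X Y} → Reach (shrunkEnds ends p) (λ _ → ⊤) (IsCut ends p) X Y → TouchedWithValue X → TouchedWithValue Y
    propagate here touched = touched
    propagate (stepˡ h h-cut _ _ rest) (g , g-cut , g-touches , ag≡α) =
      propagate rest (h , h-cut , inj₂ refl , trans (sym (a-touching g-cut h-cut g-touches (inj₁ refl))) ag≡α)
    propagate (stepʳ h h-cut _ _ rest) (g , g-cut , g-touches , ag≡α) =
      propagate rest (h , h-cut , inj₁ refl , trans (sym (a-touching g-cut h-cut g-touches (inj₂ refl))) ag≡α)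

    a-cut : ∀ f → ¬ Internal f → a f ≡ α
    a-cut f f-cut with propagate (proj₁ biconnected (p (src e₀)) (p (src f))) (e₀ , proj₂ (cut-edge connected) , inj₁ refl , refl)
    ... | g , g-cut , g-touches , ag≡α = trans (a-touching f-cut g-cut (inj₁ refl) g-touches) ag≡α

    a-indicator : ∀ e → a e ≡ (if isCut e then α else 0ℚ)
    a-indicator e with p (src e) == p (tgt e) in internal?
    ... | true  = a-internal e (==⇒≡ internal?)
    ... | false = a-cut e (==⇒≢ internal?)

    α≡ : α ≡ 1/suc j
    α≡ = *-cancelˡ-≡-pos (fromℕ-pos j) (begin
      fromℕ (suc j) * α                      ≡⟨ cong (λ k → fromℕ k * α) (tight-cutEdges tightTree tightTree-spanningTree tightTree-spansParts) ⟨
      fromℕ (count (cutEdges tightTree)) * α ≡⟨ weight-uniform tightTree isCut α (λ e _ → a-indicator e) ⟨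
      weight tightTree a                     ≡⟨ a-tight tightTree tightTree-spanningTree tightTree-spansParts ⟩
      1ℚ                                     ≡⟨ fromℕ*1/suc j ⟨
      fromℕ (suc j) * 1/suc j                ∎)
      where
      open ≡-Reasoning

    a≡cutWeight : ∀ e → a e ≡ cutWeight j e
    a≡cutWeight e = trans (a-indicator e) (trans (cong (λ x → if isCut e then x else 0ℚ) α≡) (sym (cutWeight-indicator j e)))

    b≡cutWeight : ∀ e → b e ≡ cutWeight j e
    b≡cutWeight e = mix-fixed τ<1 (trans (cutWeight≡mix e) (cong (λ x → mix τ x (b e)) (a≡cutWeight e)))

  cutWeight-isBlocker : IsBlocker ends (cutWeight j)
  cutWeight-isBlocker = cutWeight-admissible j parts≡ , λ a b τ adm-a adm-b 0<τ τ<1 cutWeight≡mix →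
    a≡cutWeight a b τ adm-a adm-b 0<τ τ<1 cutWeight≡mix , b≡cutWeight a b τ adm-a adm-b 0<τ τ<1 cutWeight≡mix

-- Extreme points are cut weights

-- ρ is the midpoint of v and the admissible 2ρ - v.
extreme-below : ∀ {n m} (ends : Fin m → Fin n × Fin n) {ρ v : Fin m → ℚ} → IsBlocker ends ρ → Adm ends v →
  (∀ e → v e ≤ ρ e) → ∀ e → v e ≡ ρ e
extreme-below ends {ρ} {v} ((ρ-nonNeg , ρ-covers) , extreme) adm-v v≤ρ e =
  proj₂ (extreme a v ½ adm-a adm-v (1/suc-pos 1) (toWitness {a? = ½ <? 1ℚ} tt) ρ≡mix) e
  where
  ½ = 1/suc 1
  a : Fin _ → ℚ
  a e = ρ e + (ρ e - v e)
  ρ≤a : ∀ e → ρ e ≤ a e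
  ρ≤a e = subst (_≤ a e) (+-identityʳ (ρ e)) (+-monoʳ-≤ (ρ e) (p≤q⇒0≤q-p (v≤ρ e)))
  adm-a : Adm ends a
  adm-a = (λ e → ≤-trans (ρ-nonNeg e) (ρ≤a e)) , λ T tree → ≤-trans (ρ-covers T tree) (weight-mono-≤ T ρ≤a)
  reflect : ∀ h r w → mix h (r + (r - w)) w ≡ r + ((1ℚ + (1ℚ + 0ℚ)) * h - 1ℚ) * (r - w)
  reflect = solve 3 (λ h r w → h :* (r :+ (r :- w)) :+ (con 1ℚ :- h) :* w
                             := r :+ ((con 1ℚ :+ (con 1ℚ :+ con 0ℚ)) :* h :- con 1ℚ) :* (r :- w)) refl
  ρ≡mix : ∀ e → ρ e ≡ mix ½ (a e) (v e)
  ρ≡mix e = sym (begin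
    mix ½ (a e) (v e)                               ≡⟨ reflect ½ (ρ e) (v e) ⟩
    ρ e + ((1ℚ + (1ℚ + 0ℚ)) * ½ - 1ℚ) * (ρ e - v e) ≡⟨ cong (λ x → ρ e + (x - 1ℚ) * (ρ e - v e)) (fromℕ*1/suc 1) ⟩
    ρ e + (1ℚ - 1ℚ) * (ρ e - v e)                   ≡⟨ solve 2 (λ r d → r :+ (con 1ℚ :- con 1ℚ) :* d := r) refl (ρ e) (ρ e - v e) ⟩
    ρ e                                             ∎)
    where open ≡-Reasoning

module ZeroComponents {n m : ℕ} (ends : Fin m → Fin n × Fin n) (ρ : Fin m → ℚ) (blocker : IsBlocker ends ρ) where
  open Graph ends
  open Kruskal ends

  private
    adm = proj₁ blocker
    extreme = proj₂ blocker

  Zero : Fin m → Set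
  Zero e = ρ e ≡ 0ℚ

  zeroForest : LabelledForest
  zeroForest = grow (λ e → ρ e ≟ℚ 0ℚ) emptyForest

  zeroForest-zero : ∀ e → In (edges zeroForest) e → Zero e
  zeroForest-zero e e∈ with grow-⊆ (λ e → ρ e ≟ℚ 0ℚ) emptyForest e∈
  ... | inj₂ e-zero = e-zero

  component : Fin n → Fin n
  component = label zeroForest

  component⇒path : ∀ u v → component u ≡ component v → Path Zero u v
  component⇒path u v same = path-mono zeroForest-zero (label⇒path zeroForest u v same)

  path⇒component : ∀ u v → Path Zero u v → component u ≡ component v
  path⇒component u v path = path⇒label zeroForest u v (grow-connects _ emptyForest path)

  several-components : ¬ (∀ u v → component u ≡ component v)
  several-components one = <-irrefl refl (<-≤-trans 0<1 (subst (1ℚ ≤_) weight≡0 (proj₂ adm (edges zeroForest) zeroForest-tree)))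
    where
    zeroForest-tree : IsSpanningTree ends (edges zeroForest)
    zeroForest-tree = (λ u v → label⇒path zeroForest u v (one u v)) , acyclic zeroForest
    weight≡0 : weight (edges zeroForest) ρ ≡ 0ℚ
    weight≡0 = trans (weight-uniform (edges zeroForest) (λ _ → false) 0ℚ zeroForest-zero)
                     (*-zeroʳ (fromℕ (count λ e → edges zeroForest e ∧ false)))

  quotient : ∃₂ λ j (p : Fin n → Fin (suc (suc j))) → Surjective _≡_ _≡_ p × SameKernel component p
  quotient with compress n component
  ... | zero , q , _ = ⊥-elim (several-components λ u → ⊥-elim (¬Fin0 (q u)))
  ... | suc zero , q , _ , _ , q⇒component = ⊥-elim (several-components λ u v → q⇒component u v (Fin1-unique (q u) (q v)))
    where
    Fin1-unique : (x y : Fin 1) → x ≡ y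
    Fin1-unique zero zero = refl
  ... | suc (suc j) , p , surjective , sameKernel = j , p , surjective , sameKernel

  module Quotient {j : ℕ} (p : Fin n → Fin (suc (suc j))) (surjective : Surjective _≡_ _≡_ p)
                  (sameKernel : SameKernel component p) where
    open CutCount ends p
    open Partition ends p
    open Tight ends p surjective

    private
      component⇒p = proj₁ sameKernel
      p⇒component = proj₂ sameKernel

    zero⇒internal : ∀ e → Zero e → Internal e
    zero⇒internal e e-zero = component⇒p _ _ (path⇒component _ _ (path-edge e e-zero))

    feasible : FeasiblePartition ends p
    feasible = surjective , λ i u v u∈i v∈i → reach-mono (λ _ _ → tt) (path-restrict (λ w → p w ≡ i)
      (λ e e-zero s∈ → trans (sym (zero⇒internal e e-zero)) s∈) (λ e e-zero t∈ → trans (zero⇒internal e e-zero) t∈)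
      (component⇒path u v (p⇒component u v (trans u∈i (sym v∈i)))) u∈i)

    cut-positive : ∀ e → IsCut ends p e → 0ℚ < ρ e
    cut-positive e cut = nonNeg≢0⇒pos (proj₁ adm e) (cut ∘ zero⇒internal e)

    private
      bound = positiveLowerBound (λ e → ¬? (p (src e) ≟ p (tgt e))) ρ cut-positive

    μ : ℚ
    μ = proj₁ bound

    0<μ : 0ℚ < μ
    0<μ = proj₁ (proj₂ bound)

    μ≤ρ : ∀ e → IsCut ends p e → μ ≤ ρ e
    μ≤ρ = proj₂ (proj₂ bound)

    θ : ℚ
    θ = fromℕ (suc j) * μ

    augment : (Fin m → Bool) → Fin m → Bool
    augment T = edges (grow (λ e → T e ≟ᵇ true) zeroForest)

    augment-spanningTree : ∀ T → IsSpanningTree ends T → IsSpanningTree ends (augment T)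
    augment-spanningTree T (spans , _) = (λ u v → grow-connects _ zeroForest (spans u v)) , acyclic (grow _ zeroForest)

    augment-spansParts : ∀ T → SpansParts (augment T)
    augment-spansParts T u v same = path-mono (λ e e∈ → grow-⊇ _ zeroForest e∈ , zero⇒internal e (zeroForest-zero e e∈))
      (label⇒path zeroForest u v (p⇒component u v same))

    augment-⊆ : ∀ T e → In (augment T) e → In T e ⊎ Zero e
    augment-⊆ T e e∈ with grow-⊆ (λ e → T e ≟ᵇ true) zeroForest e∈
    ... | inj₁ e∈zeroForest = inj₂ (zeroForest-zero e e∈zeroForest)
    ... | inj₂ e∈T          = inj₁ e∈T

    cutWeight≤ρ : 1ℚ ≤ θ → ∀ e → cutWeight j e ≤ ρ e
    cutWeight≤ρ 1≤θ e with p (src e) ≟ p (tgt e)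
    ... | yes _   = proj₁ adm e
    ... | no  cut = ≤-trans 1/suc≤μ (μ≤ρ e cut)
      where
      1/suc≤μ : 1/suc j ≤ μ
      1/suc≤μ = subst₂ _≤_ (*-identityʳ (1/suc j)) (rescale (fromℕ (suc j)) μ (1/suc j) (fromℕ*1/suc j))
        (*-monoˡ-≤-nonNeg (1/suc j) {{nonNegative (<⇒≤ (1/suc-pos j))}} 1≤θ)
        where
        rescale : ∀ k μ c → k * c ≡ 1ℚ → c * (k * μ) ≡ μ
        rescale k μ c kc≡1 = trans (solve 3 (λ k μ c → c :* (k :* μ) := (k :* c) :* μ) refl k μ c)
                                   (trans (cong (_* μ) kc≡1) (*-identityˡ μ))

    -- ρ = θ cutWeight + (1 - θ) b where b rescales ρ - μ 𝟙_{E_P}.  Replacing a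
    -- spanning tree T by a tight tree T′ ⊆ T ∪ Zero shows that b is admissible.
    module Small (θ<1 : θ < 1ℚ) where

      d : ℚ
      d = 1ℚ - θ

      0<d : 0ℚ < d
      0<d = p<q⇒0<q-p θ<1

      κ : ℚ
      κ = (1/ d) {{pos⇒nonZero d {{positive 0<d}}}}

      d*κ≡1 : d * κ ≡ 1ℚ
      d*κ≡1 = *-inverseʳ d {{pos⇒nonZero d {{positive 0<d}}}}

      0≤κ : 0ℚ ≤ κ
      0≤κ = <⇒≤ (positive⁻¹ κ {{1/pos⇒pos d {{positive 0<d}}}})

      cutShare : Fin m → ℚ
      cutShare e = if isCut e then μ else 0ℚ

      residual : Fin m → ℚ
      residual e = ρ e - cutShare e

      residual-nonNeg : ∀ e → 0ℚ ≤ residual e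
      residual-nonNeg e with p (src e) ≟ p (tgt e)
      ... | yes _   = p≤q⇒0≤q-p (proj₁ adm e)
      ... | no  cut = p≤q⇒0≤q-p (μ≤ρ e cut)

      residual-zero : ∀ e → Zero e → residual e ≡ 0ℚ
      residual-zero e e-zero rewrite ≡⇒== (zero⇒internal e e-zero) | e-zero = refl

      b : Fin m → ℚ
      b e = κ * residual e

      θ*cutWeight : ∀ e → θ * cutWeight j e ≡ cutShare e
      θ*cutWeight e with p (src e) == p (tgt e)
      ... | true  = *-zeroʳ θ
      ... | false = trans (solve 3 (λ k μ c → (k :* μ) :* c := μ :* (k :* c)) refl (fromℕ (suc j)) μ (1/suc j))
                          (trans (cong (μ *_) (fromℕ*1/suc j)) (*-identityʳ μ))

      ρ≡mix : ∀ e → ρ e ≡ mix θ (cutWeight j e) (b e)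
      ρ≡mix e = sym (begin
        θ * cutWeight j e + d * (κ * residual e) ≡⟨ cong₂ _+_ (θ*cutWeight e) (sym (*-assoc d κ (residual e))) ⟩
        cutShare e + (d * κ) * residual e        ≡⟨ cong (λ x → cutShare e + x * residual e) d*κ≡1 ⟩
        cutShare e + 1ℚ * residual e             ≡⟨ solve 2 (λ s r → s :+ con 1ℚ :* (r :- s) := r) refl (cutShare e) (ρ e) ⟩
        ρ e                                      ∎)
        where open ≡-Reasoning

      b-admissible : Adm ends b
      b-admissible = (λ e → *-nonNeg 0≤κ (residual-nonNeg e)) , covers
        where
        covers : ∀ T → IsSpanningTree ends T → 1ℚ ≤ weight T b
        covers T tree = begin
          1ℚ    ≡⟨ trans (*-comm κ d) d*κ≡1 ⟨
          κ * d ≤⟨ *-monoˡ-≤-nonNeg κ {{nonNegative 0≤κ}} (≤-trans d≤ (weight-mono-⊆ T′ T residual residual-nonNeg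
                                      λ e e∈ → map₂ (residual-zero e) (augment-⊆ T e e∈))) ⟩
          κ * weight T residual ≡⟨ weight-*ˡ T κ residual ⟨
          weight T b            ∎
          where
          open ≤-Reasoning
          T′ = augment T
          cut-part : weight T′ cutShare ≤ θ
          cut-part = subst (_≤ θ) (sym (weight-uniform T′ isCut μ λ _ _ → refl))
            (*-monoʳ-≤-nonNeg μ {{nonNegative (<⇒≤ 0<μ)}} (fromℕ-mono-≤ (tree-cutEdges-≤ T′ (augment-spanningTree T tree) (augment-spansParts T))))
          split : weight T′ ρ ≡ weight T′ residual + weight T′ cutShare
          split = trans (weight-cong T′ λ e → solve 2 (λ r s → r := (r :- s) :+ s) refl (ρ e) (cutShare e))
                        (weight-+ T′ residual cutShare)
          d≤ : d ≤ weight T′ residual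
          d≤ = 1≤x+y⇒1-z≤x (subst (1ℚ ≤_) split (proj₂ adm T′ (augment-spanningTree T tree))) cut-part

    ρ≡cutWeight : ∀ e → ρ e ≡ cutWeight j e
    ρ≡cutWeight with 1ℚ ≤? θ
    ... | yes 1≤θ = λ e → sym (extreme-below ends blocker (cutWeight-admissible j parts≡) (cutWeight≤ρ 1≤θ) e)
    ... | no  1≰θ = λ e → sym (proj₁ (extreme (cutWeight j) b θ (cutWeight-admissible j parts≡) b-admissible
                                              (*-pos (fromℕ-pos j) 0<μ) (≰⇒> 1≰θ) ρ≡mix) e)
      where open Small (≰⇒> 1≰θ)

-- Extreme cut weights have a biconnected shrunk graph

image-collapse : ∀ {n k} (p : Fin n → Fin k) → Surjective _≡_ _≡_ p → (S : Fin k → Bool) (x : Fin k) →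
  ∀ y → image (λ u → if S (p u) then p u else x) y ≡ S y ∨ (y == x)
image-collapse p surjective S x y = bool-ext to from
  where
  collapse : Fin _ → Fin _
  collapse z = if S z then z else x
  collapse-x : collapse x ≡ x
  collapse-x with S x
  ... | true  = refl
  ... | false = refl
  to : image (collapse ∘ p) y ≡ true → S y ∨ (y == x) ≡ true
  to y∈ with image-elim (collapse ∘ p) y∈
  ... | u , collapsed with S (p u) in Spu
  ...   | true  = ∨-introˡ (subst (λ z → S z ≡ true) collapsed Spu)
  ...   | false = ∨-introʳ {S y} (≡⇒== (sym collapsed))
  from : S y ∨ (y == x) ≡ true → image (collapse ∘ p) y ≡ true
  from h with ∨-elim {S y} h
  ... | inj₁ Sy  = image-intro (collapse ∘ p) {proj₁ (surjective y)}
                     (trans (cong collapse (proj₂ (surjective y) refl)) (subst (λ b → (if b then y else x) ≡ y) (sym Sy) refl))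
  ... | inj₂ y=x = image-intro (collapse ∘ p) {proj₁ (surjective x)}
                     (trans (cong collapse (proj₂ (surjective x) refl)) (trans collapse-x (sym (==⇒≡ y=x))))

two≤⇒ : ∀ {k} → 2 ℕ.≤ k → ∃ λ i → k ≡ suc (suc i)
two≤⇒ (s≤s (s≤s {n = i} _)) = i , refl

module Biconnectivity {n m j : ℕ} (ends : Fin m → Fin n × Fin n) (connected : Connected ends)
                      (p : Fin n → Fin (suc (suc j))) (surjective : Surjective _≡_ _≡_ p)
                      (blocker : IsBlocker ends (Partition.cutWeight ends p j)) where
  open Graph ends
  open CutCount ends p
  open Partition ends p
  open Tight ends p surjective

  shrunk : Fin m → Fin (suc (suc j)) × Fin (suc (suc j))
  shrunk = shrunkEnds ends p

  module Shrunk = Graph shrunk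
  module ShrunkKruskal = Kruskal shrunk

  project : ∀ {u v} → Path (λ _ → ⊤) u v → Reach shrunk (λ _ → ⊤) (IsCut ends p) (p u) (p v)
  project here = here
  project {v = v} (stepˡ g _ _ _ rest) with p (src g) ≟ p (tgt g)
  ... | yes internal = subst (λ z → Reach shrunk (λ _ → ⊤) (IsCut ends p) z (p v)) (sym internal) (project rest)
  ... | no cut       = stepˡ g cut tt tt (project rest)
  project {v = v} (stepʳ g _ _ _ rest) with p (src g) ≟ p (tgt g)
  ... | yes internal = subst (λ z → Reach shrunk (λ _ → ⊤) (IsCut ends p) z (p v)) internal (project rest)
  ... | no cut       = stepʳ g cut tt tt (project rest)

  shrunk-connected : ∀ A B → Reach shrunk (λ _ → ⊤) (IsCut ends p) A B
  shrunk-connected A B = subst₂ (Reach shrunk (λ _ → ⊤) (IsCut ends p)) (proj₂ (surjective A) refl) (proj₂ (surjective B) refl)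
    (project (connected (proj₁ (surjective A)) (proj₁ (surjective B))))

  module WithoutVertex (x : Fin (suc (suc j))) where

    Avoiding : Fin m → Set
    Avoiding g = IsCut ends p g × p (src g) ≢ x × p (tgt g) ≢ x

    avoidingForest : ShrunkKruskal.LabelledForest
    avoidingForest = ShrunkKruskal.grow (λ g → ¬? (p (src g) ≟ p (tgt g)) ×-dec ¬? (p (src g) ≟ x) ×-dec ¬? (p (tgt g) ≟ x))
                                    ShrunkKruskal.emptyForest

    component : Fin (suc (suc j)) → Fin (suc (suc j))
    component = ShrunkKruskal.label avoidingForest

    component⇒path : ∀ A B → component A ≡ component B → Shrunk.Path Avoiding A B
    component⇒path A B same = Shrunk.path-mono (λ g g∈ → avoiding g (ShrunkKruskal.grow-⊆ _ _ g∈))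
                                       (ShrunkKruskal.label⇒path avoidingForest A B same)
      where
      avoiding : ∀ g → Shrunk.In (λ _ → false) g ⊎ Avoiding g → Avoiding g
      avoiding g (inj₂ avoids) = avoids

    path⇒component : ∀ A B → Shrunk.Path Avoiding A B → component A ≡ component B
    path⇒component A B path = ShrunkKruskal.path⇒label avoidingForest A B (ShrunkKruskal.grow-connects _ _ path)

    -- If x separates a from b, let C be the parts in the component of a in
    -- G_P - x and D the others.  Collapsing D into x (q₁), resp. C into x (q₂),
    -- splits cutWeight j into a proper convex combination of their cut weights.
    module Split (a b : Fin (suc (suc j))) (a≢x : a ≢ x) (b≢x : b ≢ x) (apart : component a ≢ component b) where

      inC inD : Fin (suc (suc j)) → Bool
      inC y = not (y == x) ∧ (component a == component y)
      inD y = not (y == x) ∧ not (component a == component y)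

      f₁ f₂ : Fin (suc (suc j)) → Fin (suc (suc j))
      f₁ y = if inC y then y else x
      f₂ y = if inD y then y else x

      data Side (y : Fin (suc (suc j))) : Set where
        centre : y ≡ x → Side y
        left   : y ≢ x → component a ≡ component y → Side y
        right  : y ≢ x → component a ≢ component y → Side y

      side : ∀ y → Side y
      side y with y ≟ x | component a ≟ component y
      ... | yes y≡x | _       = centre y≡x
      ... | no y≢x  | yes same = left y≢x same
      ... | no y≢x  | no other = right y≢x other

      f₁-centre : f₁ x ≡ x
      f₁-centre with inC x
      ... | true  = refl
      ... | false = refl

      f₂-centre : f₂ x ≡ x
      f₂-centre with inD x
      ... | true  = refl
      ... | false = refl

      f₁-left : ∀ {y} → y ≢ x → component a ≡ component y → f₁ y ≡ y
      f₁-left y≢x same rewrite ≢⇒== y≢x | ≡⇒== same = refl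

      f₂-left : ∀ {y} → y ≢ x → component a ≡ component y → f₂ y ≡ x
      f₂-left y≢x same rewrite ≢⇒== y≢x | ≡⇒== same = refl

      f₁-right : ∀ {y} → y ≢ x → component a ≢ component y → f₁ y ≡ x
      f₁-right y≢x other rewrite ≢⇒== y≢x | ≢⇒== other = refl

      f₂-right : ∀ {y} → y ≢ x → component a ≢ component y → f₂ y ≡ y
      f₂-right y≢x other rewrite ≢⇒== y≢x | ≢⇒== other = refl

      no-left-right : ∀ {A B} → component a ≡ component A → component a ≢ component B → ¬ Shrunk.Path Avoiding A B
      no-left-right A-left B-right path = B-right (trans A-left (path⇒component _ _ path))

      data Kind (A B : Fin (suc (suc j))) : Set where
        internal : A ≡ B → Kind A B
        leftCut  : A ≢ B → f₁ A ≢ f₁ B → f₂ A ≡ f₂ B → Kind A B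
        rightCut : A ≢ B → f₁ A ≡ f₁ B → f₂ A ≢ f₂ B → Kind A B

      kind : ∀ g → Kind (p (src g)) (p (tgt g))
      kind g with side (p (src g)) | side (p (tgt g))
      ... | centre refl | centre B≡x = internal (sym B≡x)
      ... | centre refl | left B≢x B-left = leftCut (B≢x ∘ sym)
            (λ f₁≡ → B≢x (trans (sym (f₁-left B≢x B-left)) (trans (sym f₁≡) f₁-centre))) (trans f₂-centre (sym (f₂-left B≢x B-left)))
      ... | centre refl | right B≢x B-right = rightCut (B≢x ∘ sym)
            (trans f₁-centre (sym (f₁-right B≢x B-right))) (λ f₂≡ → B≢x (trans (sym (f₂-right B≢x B-right)) (trans (sym f₂≡) f₂-centre)))
      ... | left A≢x A-left | centre refl = leftCut A≢x
            (λ f₁≡ → A≢x (trans (sym (f₁-left A≢x A-left)) (trans f₁≡ f₁-centre))) (trans (f₂-left A≢x A-left) (sym f₂-centre))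
      ... | right A≢x A-right | centre refl = rightCut A≢x
            (trans (f₁-right A≢x A-right) (sym f₁-centre)) (λ f₂≡ → A≢x (trans (sym (f₂-right A≢x A-right)) (trans f₂≡ f₂-centre)))
      ... | left A≢x A-left | right B≢x B-right = ⊥-elim (no-left-right A-left B-right
            (Shrunk.path-edge g ((λ A≡B → B-right (trans A-left (cong component A≡B))) , A≢x , B≢x)))
      ... | right A≢x A-right | left B≢x B-left = ⊥-elim (no-left-right B-left A-right
            (Shrunk.path-edge˘ g ((λ A≡B → A-right (trans B-left (cong component (sym A≡B)))) , A≢x , B≢x)))
      ... | left A≢x A-left | left B≢x B-left with p (src g) ≟ p (tgt g)
      ...   | yes A≡B = internal A≡B
      ...   | no A≢B  = leftCut A≢B (λ f₁≡ → A≢B (trans (sym (f₁-left A≢x A-left)) (trans f₁≡ (f₁-left B≢x B-left))))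
                          (trans (f₂-left A≢x A-left) (sym (f₂-left B≢x B-left)))
      kind g | right A≢x A-right | right B≢x B-right with p (src g) ≟ p (tgt g)
      ...   | yes A≡B = internal A≡B
      ...   | no A≢B  = rightCut A≢B (trans (f₁-right A≢x A-right) (sym (f₁-right B≢x B-right)))
                          (λ f₂≡ → A≢B (trans (sym (f₂-right A≢x A-right)) (trans f₂≡ (f₂-right B≢x B-right))))

      q₁ q₂ : Fin n → Fin (suc (suc j))
      q₁ = f₁ ∘ p
      q₂ = f₂ ∘ p

      C∪x D∪x : Fin (suc (suc j)) → Bool
      C∪x y = inC y ∨ (y == x)
      D∪x y = inD y ∨ (y == x)

      covering : ∀ y → (C∪x y ∨ D∪x y) ≡ true
      covering y with y == x | component a == component y
      ... | true  | _     = refl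
      ... | false | true  = refl
      ... | false | false = refl

      meet : ∀ y → (C∪x y ∧ D∪x y) ≡ (y == x)
      meet y with y == x | component a == component y
      ... | true  | _     = refl
      ... | false | true  = refl
      ... | false | false = refl

      sizes : count C∪x ℕ.+ count D∪x ≡ suc (suc (suc j))
      sizes = begin
        count C∪x ℕ.+ count D∪x                                     ≡⟨ count-∨-∧ C∪x D∪x ⟨
        count (λ y → C∪x y ∨ D∪x y) ℕ.+ count (λ y → C∪x y ∧ D∪x y) ≡⟨ cong₂ ℕ._+_ (trans (count-cong _ _ covering) (count-true _))
                                                                                             (trans (count-cong _ _ meet) (count-single x)) ⟩
        suc (suc j) ℕ.+ 1 ≡⟨ ℕ.+-comm (suc (suc j)) 1 ⟩
        suc (suc (suc j)) ∎
        where open ≡-Reasoning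

      two-parts : ∀ (S : Fin (suc (suc j)) → Bool) {y} → y ≢ x → (S y ∨ (y == x)) ≡ true → 2 ℕ.≤ count (λ z → S z ∨ (z == x))
      two-parts S {y} y≢x y∈ = subst (2 ℕ.≤_) (count-remove (λ z → S z ∨ (z == x)) x (∨-introʳ {S x} (==-refl x)))
        (s≤s (count-pos (λ z → (S z ∨ (z == x)) ∧ not (z == x)) y (∧-intro y∈ (not-intro (≢⇒== y≢x)))))

      a∈C : C∪x a ≡ true
      a∈C rewrite ≢⇒== a≢x | ==-refl (component a) = refl

      b∈D : D∪x b ≡ true
      b∈D rewrite ≢⇒== b≢x | ≢⇒== apart = refl

      crossing : ∃ λ g → f₂ (p (src g)) ≢ f₂ (p (tgt g))
      crossing with path-crossing (λ w → f₂ (p w) ≡ x) (λ w → f₂ (p w) ≟ x) (connected (proj₁ (surjective x)) (proj₁ (surjective b)))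
                                  (trans (cong f₂ (proj₂ (surjective x) refl)) f₂-centre)
                                  (λ f₂b≡x → b≢x (trans (sym (f₂-right b≢x apart)) (trans (cong f₂ (sym (proj₂ (surjective b) refl))) f₂b≡x)))
      ... | g , _ , inj₁ (s∈ , t∉) = g , λ f₂≡ → t∉ (trans (sym f₂≡) s∈)
      ... | g , _ , inj₂ (s∉ , t∈) = g , λ f₂≡ → s∉ (trans f₂≡ t∈)

      module Weights (i₁ i₂ : ℕ) (C-size : count C∪x ≡ suc (suc i₁)) (D-size : count D∪x ≡ suc (suc i₂)) where

        module P₁ = Partition ends q₁
        module P₂ = Partition ends q₂

        parts₁ : count (image q₁) ≡ suc (suc i₁)
        parts₁ = trans (count-cong _ _ (image-collapse p surjective inC x)) C-size

        parts₂ : count (image q₂) ≡ suc (suc i₂)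
        parts₂ = trans (count-cong _ _ (image-collapse p surjective inD x)) D-size

        i₁+i₂ : suc i₁ ℕ.+ suc i₂ ≡ suc j
        i₁+i₂ = ℕ.suc-injective (ℕ.suc-injective (begin
          suc (suc (suc i₁ ℕ.+ suc i₂)) ≡⟨ cong suc (ℕ.+-suc (suc i₁) (suc i₂)) ⟨
          suc (suc i₁ ℕ.+ suc (suc i₂)) ≡⟨ cong₂ ℕ._+_ C-size D-size ⟨
          count C∪x ℕ.+ count D∪x       ≡⟨ sizes ⟩
          suc (suc (suc j))             ∎))
          where open ≡-Reasoning

        τ : ℚ
        τ = fromℕ (suc i₁) * 1/suc j

        1-τ : 1ℚ - τ ≡ fromℕ (suc i₂) * 1/suc j
        1-τ = begin
          1ℚ - τ                                          ≡⟨ cong (_- τ) (fromℕ*1/suc j) ⟨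
          fromℕ (suc j) * 1/suc j - τ                     ≡⟨ cong (λ k → fromℕ k * 1/suc j - τ) i₁+i₂ ⟨
          fromℕ (suc i₁ ℕ.+ suc i₂) * 1/suc j - τ         ≡⟨ cong (λ y → y * 1/suc j - τ) (fromℕ-+ (suc i₁) (suc i₂)) ⟩
          (fromℕ (suc i₁) + fromℕ (suc i₂)) * 1/suc j - τ ≡⟨ solve 3 (λ s t c → (s :+ t) :* c :- s :* c := t :* c) refl
                                                                        (fromℕ (suc i₁)) (fromℕ (suc i₂)) (1/suc j) ⟩
          fromℕ (suc i₂) * 1/suc j                                 ∎
          where open ≡-Reasoning

        0<τ : 0ℚ < τ
        0<τ = *-pos (fromℕ-pos i₁) (1/suc-pos j)

        τ<1 : τ < 1ℚ
        τ<1 = 0<q-p⇒p<q (subst (0ℚ <_) (sym 1-τ) (*-pos (fromℕ-pos i₂) (1/suc-pos j)))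

        share : ∀ i s → s ≡ fromℕ (suc i) * 1/suc j → s * 1/suc i ≡ 1/suc j
        share i s refl = trans (solve 3 (λ k c d → (k :* c) :* d := c :* (k :* d)) refl (fromℕ (suc i)) (1/suc j) (1/suc i))
                               (trans (cong (1/suc j *_) (fromℕ*1/suc i)) (*-identityʳ (1/suc j)))

        split : ∀ g → cutWeight j g ≡ mix τ (P₁.cutWeight i₁ g) (P₂.cutWeight i₂ g)
        split g with kind g
        ... | internal A≡B = begin
          cutWeight j g                                 ≡⟨ cutWeight-internal j A≡B ⟩
          0ℚ                                            ≡⟨ mix-0-0 τ ⟨
          mix τ 0ℚ 0ℚ                                   ≡⟨ cong₂ (mix τ) (P₁.cutWeight-internal i₁ (cong f₁ A≡B)) (P₂.cutWeight-internal i₂ (cong f₂ A≡B)) ⟨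
          mix τ (P₁.cutWeight i₁ g) (P₂.cutWeight i₂ g) ∎
          where open ≡-Reasoning
        ... | leftCut A≢B f₁≢ f₂≡ = begin
          cutWeight j g                                 ≡⟨ cutWeight-cut j A≢B ⟩
          1/suc j                                       ≡⟨ share i₁ τ refl ⟨
          τ * 1/suc i₁                                  ≡⟨ mix-x-0 τ (1/suc i₁) ⟨
          mix τ (1/suc i₁) 0ℚ                           ≡⟨ cong₂ (mix τ) (P₁.cutWeight-cut i₁ f₁≢) (P₂.cutWeight-internal i₂ f₂≡) ⟨
          mix τ (P₁.cutWeight i₁ g) (P₂.cutWeight i₂ g) ∎
          where open ≡-Reasoning
        ... | rightCut A≢B f₁≡ f₂≢ = begin
          cutWeight j g                                 ≡⟨ cutWeight-cut j A≢B ⟩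
          1/suc j                                       ≡⟨ share i₂ (1ℚ - τ) 1-τ ⟨
          (1ℚ - τ) * 1/suc i₂                           ≡⟨ mix-0-y τ (1/suc i₂) ⟨
          mix τ 0ℚ (1/suc i₂)                           ≡⟨ cong₂ (mix τ) (P₁.cutWeight-internal i₁ f₁≡) (P₂.cutWeight-cut i₂ f₂≢) ⟨
          mix τ (P₁.cutWeight i₁ g) (P₂.cutWeight i₂ g) ∎
          where open ≡-Reasoning

        impossible : ⊥
        impossible with crossing
        ... | g , f₂≢ with kind g
        ...   | internal A≡B   = f₂≢ (cong f₂ A≡B)
        ...   | leftCut _ _ f₂≡ = f₂≢ f₂≡
        ...   | rightCut A≢B f₁≡ _ = <-irrefl refl (subst (0ℚ <_) 1/suc≡0 (1/suc-pos j))
          where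
          same-weight = proj₁ (proj₂ blocker (P₁.cutWeight i₁) (P₂.cutWeight i₂) τ (P₁.cutWeight-admissible i₁ parts₁)
                                       (P₂.cutWeight-admissible i₂ parts₂) 0<τ τ<1 split) g
          1/suc≡0 : 1/suc j ≡ 0ℚ
          1/suc≡0 = trans (sym (cutWeight-cut j A≢B)) (trans (sym same-weight) (P₁.cutWeight-internal i₁ f₁≡))

      impossible : ⊥
      impossible with two≤⇒ (two-parts inC a≢x a∈C) | two≤⇒ (two-parts inD b≢x b∈D)
      ... | i₁ , C-size | i₂ , D-size = Weights.impossible i₁ i₂ C-size D-size

  shrunk-biconnected : ShrunkBiconnected ends p
  shrunk-biconnected = shrunk-connected , λ x A B A≢x B≢x → separated x A B A≢x B≢x
    where
    separated : ∀ x A B → A ≢ x → B ≢ x → Reach shrunk (_≢ x) (IsCut ends p) A B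
    separated x A B A≢x B≢x with WithoutVertex.component x A ≟ WithoutVertex.component x B
    ... | yes same = Shrunk.path⇒reach (WithoutVertex.component⇒path x A B same)
    ... | no apart = ⊥-elim (WithoutVertex.Split.impossible x A B A≢x B≢x apart)

BiconnectedCutVector : ∀ {n m} → (Fin m → Fin n × Fin n) → (Fin m → ℚ) → Set
BiconnectedCutVector {n} {m} ends ρ = Σ ℕ (λ j → Σ (Fin n → Fin (suc (suc j))) (λ p →
  FeasiblePartition ends p × ShrunkBiconnected ends p × ((e : Fin m) → ρ e ≡ cutVector j ends p e)))

biconnectedCutVector⇒blocker : ∀ {n m} (ends : Fin m → Fin n × Fin n) → Connected ends → ∀ {ρ} →
  BiconnectedCutVector ends ρ → IsBlocker ends ρ
biconnectedCutVector⇒blocker ends connected (j , p , feasible , biconnected , ρ≡cutVector) =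
  IsBlocker-cong ends (λ e → sym (ρ≡cutVector e)) (Extreme.cutWeight-isBlocker ends connected p feasible biconnected)

blocker⇒biconnectedCutVector : ∀ {n m} (ends : Fin m → Fin n × Fin n) → Connected ends → ∀ {ρ} →
  IsBlocker ends ρ → BiconnectedCutVector ends ρ
blocker⇒biconnectedCutVector ends connected {ρ} blocker with ZeroComponents.quotient ends ρ blocker
... | j , p , surjective , sameKernel = j , p , feasible , shrunk-biconnected , ρ≡cutWeight
  where
  open ZeroComponents.Quotient ends ρ blocker p surjective sameKernel
  open Biconnectivity ends connected p surjective (IsBlocker-cong ends ρ≡cutWeight blocker)

mainTheorem1 : (n m : ℕ) (ends : Fin m → Fin n × Fin n) →
    Loopless ends → Connected ends →
    (ρ : Fin m → ℚ) →
    IsBlocker ends ρ ⇔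
      Σ ℕ (λ j → Σ (Fin n → Fin (suc (suc j))) (λ p →
        FeasiblePartition ends p × ShrunkBiconnected ends p ×
        ((e : Fin m) → ρ e ≡ cutVector j ends p e)))
mainTheorem1 n m ends _ connected ρ =
  mk⇔ (blocker⇒biconnectedCutVector ends connected) (biconnectedCutVector⇒blocker ends connected)
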